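{- For every integer $c \geq 6$ and every integer $v \geq c$, there exists a $(3 \times c, v)$-near triple array.
   Context: An $r\times c$ row-column design on $v$ symbols is an $r\times c$ array each of whose cells is filled with one of $v$ symbols (not every symbol need be used). It is binary if no symbol occurs more than once in any row or in any column. Let $e=rc/v$, $e^-=\lfloor e\rfloor$, $e^+=\lceil e\rceil$. The design is equireplicate if $e$ is an integer and every symbol occurs exactly $e$ times, and near equireplicate if $e$ is not an integer and every symbol occurs either $e^-$ or $e^+$ times. For a binary design with $r,c\ge 2$, let $R_i$, $C_j$ be the sets of symbols in row $i$ and column $j$, and put $\lambda_{rc}=\frac{1}{rc}\sum_{i,j}|R_i\cap C_j|$, $\lambda_{rr}=\binom{r}{2}^{ -1}\sum_{i<j}|R_i\cap R_j|$, $\lambda_{cc}=\binom{c}{2}^{ -1}\sum_{i<j}|C_i\cap C_j|$; for a real $x$ write $x^-=\lfloor x\rfloor$, $x^+=\lceil x\rceil$. An $(r\times c,v)$-near triple array is a binary $r\times c$ row-column design on $v$ symbols which is equireplicate or near equireplicate and in which every row and every column have $\lambda_{rc}^-$ or $\lambda_{rc}^+$ common symbols, every two distinct rows have $\lambda_{rr}^-$ or $\lambda_{rr}^+$ common symbols, and every two distinct columns have $\lambda_{cc}^-$ or $\lambda_{cc}^+$ common symbols. -}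

module Defs where

open import Data.Nat using (ℕ; zero; suc; _+_; _*_; _/_; _<_; _≤_; _<?_)
open import Data.Nat.Combinatorics using (_C_)
import Data.Fin
open import Data.Fin using (Fin; toℕ)
open import Data.Fin.Properties using (_≟_)
open import Data.Bool using (Bool; true; false; _∧_; _∨_; if_then_else_)
open import Data.Product using (_×_)
open import Data.Sum using (_⊎_)
open import Relation.Nullary using (¬_)
open import Relation.Nullary.Decidable using (⌊_⌋)
open import Relation.Binary.PropositionalEquality using (_≡_)

Design : ℕ → ℕ → ℕ → Set
Design r c v = Fin r → Fin c → Fin v

sumF : ∀ {n} → (Fin n → ℕ) → ℕ
sumF {zero}  f = 0
sumF {suc n} f = f Data.Fin.zero + sumF (λ i → f (Data.Fin.suc i))

countF : ∀ {n} → (Fin n → Bool) → ℕ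
countF p = sumF (λ i → if p i then 1 else 0)

anyF : ∀ {n} → (Fin n → Bool) → Bool
anyF {zero}  p = false
anyF {suc n} p = p Data.Fin.zero ∨ anyF (λ i → p (Data.Fin.suc i))

-- floor and ceiling of the rational a / b (b ≥ 1; value 0 for b = 0, never used)
floorDiv : ℕ → ℕ → ℕ
floorDiv a zero    = 0
floorDiv a (suc b) = a / suc b

ceilDiv : ℕ → ℕ → ℕ
ceilDiv a zero    = 0
ceilDiv a (suc b) = (a + b) / suc b

FloorOrCeil : ℕ → ℕ → ℕ → Set
FloorOrCeil x a b = (x ≡ floorDiv a b) ⊎ (x ≡ ceilDiv a b)

module _ {r c v : ℕ} (A : Design r c v) where

  Binary : Set
  Binary = (∀ i j j′ → A i j ≡ A i j′ → j ≡ j′)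
         × (∀ i i′ j → A i j ≡ A i′ j → i ≡ i′)

  replication : Fin v → ℕ
  replication s = sumF (λ i → countF (λ j → ⌊ A i j ≟ s ⌋))

  Equireplicate : Set
  Equireplicate = (floorDiv (r * c) v ≡ ceilDiv (r * c) v)
                × (∀ s → replication s ≡ floorDiv (r * c) v)

  NearEquireplicate : Set
  NearEquireplicate = ¬ (floorDiv (r * c) v ≡ ceilDiv (r * c) v)
                    × (∀ s → FloorOrCeil (replication s) (r * c) v)

  inRow : Fin r → Fin v → Bool
  inRow i s = anyF (λ j → ⌊ A i j ≟ s ⌋)

  inCol : Fin c → Fin v → Bool
  inCol j s = anyF (λ i → ⌊ A i j ≟ s ⌋)

  rowCol : Fin r → Fin c → ℕ
  rowCol i j = countF (λ s → inRow i s ∧ inCol j s)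

  rowRow : Fin r → Fin r → ℕ
  rowRow i i′ = countF (λ s → inRow i s ∧ inRow i′ s)

  colCol : Fin c → Fin c → ℕ
  colCol j j′ = countF (λ s → inCol j s ∧ inCol j′ s)

  -- numerators of λ_rc, λ_rr, λ_cc (denominators rc, (r choose 2), (c choose 2))
  sumRC : ℕ
  sumRC = sumF (λ i → sumF (λ j → rowCol i j))

  sumRR : ℕ
  sumRR = sumF (λ i → sumF (λ i′ → if ⌊ toℕ i <? toℕ i′ ⌋ then rowRow i i′ else 0))

  sumCC : ℕ
  sumCC = sumF (λ j → sumF (λ j′ → if ⌊ toℕ j <? toℕ j′ ⌋ then colCol j j′ else 0))

  NearTripleArrayProp : Set
  NearTripleArrayProp =
      Binary
    × (Equireplicate ⊎ NearEquireplicate)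
    × (∀ i j → FloorOrCeil (rowCol i j) sumRC (r * c))
    × (∀ i i′ → ¬ i ≡ i′ → FloorOrCeil (rowRow i i′) sumRR (r C 2))
    × (∀ j j′ → ¬ j ≡ j′ → FloorOrCeil (colCol j j′) sumCC (c C 2))

-- an (r × c , v)-near triple array (the definition presupposes r , c ≥ 2)
record NearTripleArray (r c v : ℕ) : Set where
  field
    array : Design r c v
    isNTA : NearTripleArrayProp array

module Submission where

-- If every replication number and every intersection size |R_i ∩ C_j|, |R_i ∩ R_i′|, |C_j ∩ C_j′| takes
-- one of two consecutive values m, 1 + m, the design is a near triple array: the members of a family of
-- naturals with values in {m, 1 + m} are floors or ceilings of its average. This property survives
-- juxtaposing two designs on disjoint symbol sets when all row intersections of one of them are equal:
-- replications and row–column intersections are inherited, columns from different parts are disjoint and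
-- row intersections add up. For v ≥ 3c, juxtapose c columns of three fresh symbols. For 8 ≤ c ≤ v < 3c, repeatedly split off a 3 × 6 array on 9 symbols, the 3 × 7 Youden square of
-- the Fano plane or a single column until one of finitely many explicit base arrays is reached; the cases
-- c ∈ {6, 7} are covered by explicit arrays alone. All explicit arrays are checked by evaluation.

open import Defs
open import Data.Bool using (Bool; true; false; _∧_; _∨_; if_then_else_; T)
open import Data.Bool.Properties using (∨-assoc; ∨-identityʳ; ∧-comm; ∧-zeroʳ)
open import Data.Empty using (⊥-elim)
open import Data.Fin using (Fin; zero; suc; toℕ; _↑ˡ_; _↑ʳ_; splitAt; #_)
open import Data.Fin.Properties
  using (_≟_; all?; <-cmp; suc-injective; ↑ˡ-injective; ↑ʳ-injective; splitAt-↑ˡ; splitAt-↑ʳ)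
open import Data.Maybe using (Maybe; just; nothing)
open import Data.Maybe.Relation.Unary.Any as Any using (Any; just)
open import Data.Nat using (ℕ; zero; suc; _+_; _*_; _/_; _≤_; _<_; _≤?_; _<?_; z≤n; s≤s; z<s)
open import Data.Nat.Combinatorics using (_C_; nCk+nC[k+1]≡[n+1]C[k+1]; nC1≡n)
open import Data.Nat.DivMod using (m<n*o⇒m/o<n; /-monoˡ-≤; m*n/n≡m)
open import Data.Nat.Induction using (<-rec)
open import Data.Nat.Properties
  using (+-assoc; +-identityʳ; +-suc; *-identityʳ; *-comm; *-suc; ≤-refl; ≤-trans; ≤-antisym; ≤-pred; <⇒≤;
         <⇒≤pred; <-irrefl; ≤-<-trans; <-≤-trans; ≰⇒>; ≮⇒≥; n<1+n; n≤1+n; m≤m+n; m≤n+m; m<n+m; +-mono-≤;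
         +-mono-≤-<; +-mono-<-≤; +-monoˡ-≤; +-monoˡ-<; +-monoʳ-<; +-cancelˡ-≤; +-cancelˡ-<; *-monoˡ-≤;
         *-monoʳ-≤; *-cancelʳ-≤; *-cancelʳ-<; allUpTo?; +-*-semiring; module ≤-Reasoning)
  renaming (_≟_ to _≟ℕ_)
open import Algebra.Properties.Semiring.Sum +-*-semiring using (sum; ∑-comm; *-distribʳ-sum)
open import Data.Nat.Tactic.RingSolver using (solve-∀)
open import Data.Product using (_,_; ∃; proj₁; proj₂; uncurry)
open import Data.Sum using (_⊎_; inj₁; inj₂; [_,_]′)
open import Data.Unit using (tt)
open import Data.Vec using (Vec; []; _∷_; lookup)
open import Function using (_∘_; id)
open import Relation.Binary.Definitions using (tri<; tri≈; tri>)
open import Relation.Binary.PropositionalEquality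
open import Relation.Nullary using (Dec; yes; no)
open import Relation.Nullary.Decidable
  using (True; ⌊_⌋; _×-dec_; _⊎-dec_; _→-dec_; ¬?; map′; from-yes; toWitness; fromWitness; ⌊⌋-map′; isYes≗does;
         dec-false)

sumF-cong : ∀ {n} {f g : Fin n → ℕ} → (∀ i → f i ≡ g i) → sumF f ≡ sumF g
sumF-cong {zero}  f≗g = refl
sumF-cong {suc n} f≗g = cong₂ _+_ (f≗g zero) (sumF-cong (f≗g ∘ suc))

sumF≡sum : ∀ {n} (f : Fin n → ℕ) → sumF f ≡ sum f
sumF≡sum {zero}  f = refl
sumF≡sum {suc n} f = cong (f zero +_) (sumF≡sum (f ∘ suc))

sumF-comm : ∀ {m n} (f : Fin m → Fin n → ℕ) → sumF (λ i → sumF (f i)) ≡ sumF (λ j → sumF (λ i → f i j))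
sumF-comm f = begin
  sumF (λ i → sumF (f i))          ≡⟨ sumF-cong (λ i → sumF≡sum (f i)) ⟩
  sumF (λ i → sum (f i))           ≡⟨ sumF≡sum (λ i → sum (f i)) ⟩
  sum (λ i → sum (f i))            ≡⟨ ∑-comm f ⟩
  sum (λ j → sum (λ i → f i j))    ≡⟨ sumF≡sum (λ j → sum (λ i → f i j)) ⟨
  sumF (λ j → sum (λ i → f i j))   ≡⟨ sumF-cong (λ j → sumF≡sum (λ i → f i j)) ⟨
  sumF (λ j → sumF (λ i → f i j))  ∎
  where open ≡-Reasoning

sumF-distribʳ : ∀ {n} (f : Fin n → ℕ) m → sumF f * m ≡ sumF (λ i → f i * m)
sumF-distribʳ f m = begin
  sumF f * m            ≡⟨ cong (_* m) (sumF≡sum f) ⟩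
  sum f * m             ≡⟨ *-distribʳ-sum m f ⟩
  sum (λ i → f i * m)   ≡⟨ sumF≡sum (λ i → f i * m) ⟨
  sumF (λ i → f i * m)  ∎
  where open ≡-Reasoning

sumF-const : ∀ n m → sumF {n} (λ _ → m) ≡ n * m
sumF-const zero    m = refl
sumF-const (suc n) m = cong (m +_) (sumF-const n m)

sumF-ones : ∀ n → sumF {n} (λ _ → 1) ≡ n
sumF-ones n = trans (sumF-const n 1) (*-identityʳ n)

sumF-mono-≤ : ∀ {n} {f g : Fin n → ℕ} → (∀ i → f i ≤ g i) → sumF f ≤ sumF g
sumF-mono-≤ {zero}  f≤g = z≤n
sumF-mono-≤ {suc n} f≤g = +-mono-≤ (f≤g zero) (sumF-mono-≤ (f≤g ∘ suc))

sumF-mono-< : ∀ {n} {f g : Fin n → ℕ} → (∀ i → f i ≤ g i) → ∀ k → f k < g k → sumF f < sumF g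
sumF-mono-< f≤g zero    fk<gk = +-mono-<-≤ fk<gk (sumF-mono-≤ (f≤g ∘ suc))
sumF-mono-< f≤g (suc k) fk<gk = +-mono-≤-< (f≤g zero) (sumF-mono-< (f≤g ∘ suc) k fk<gk)

sumF-↑ : ∀ m {n} (f : Fin (m + n) → ℕ) → sumF f ≡ sumF (λ i → f (i ↑ˡ n)) + sumF (λ j → f (m ↑ʳ j))
sumF-↑ zero    f = refl
sumF-↑ (suc m) f = trans (cong (f zero +_) (sumF-↑ m (f ∘ suc))) (sym (+-assoc (f zero) _ _))

countF-cong : ∀ {n} {p q : Fin n → Bool} → (∀ i → p i ≡ q i) → countF p ≡ countF q
countF-cong p≗q = sumF-cong (λ i → cong (λ b → if b then 1 else 0) (p≗q i))

countF-false : ∀ {n} {p : Fin n → Bool} → (∀ i → p i ≡ false) → countF p ≡ 0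
countF-false {zero}  p≗false = refl
countF-false {suc n} p≗false rewrite p≗false zero = countF-false (p≗false ∘ suc)

countF-≟ : ∀ {n} (x : Fin n) → countF (λ s → ⌊ x ≟ s ⌋) ≡ 1
countF-≟ {suc n} zero    = cong suc (countF-false {n} (λ _ → refl))
countF-≟ {suc n} (suc x) = trans (countF-cong (λ s → ⌊⌋-map′ _ _ (x ≟ s))) (countF-≟ x)

countF-↑ˡ : ∀ m {n} {p : Fin (m + n) → Bool} → (∀ j → p (m ↑ʳ j) ≡ false) →
            countF p ≡ countF (λ i → p (i ↑ˡ n))
countF-↑ˡ m {n} {p} right≡false =
  trans (sumF-↑ m _) (trans (cong (countF (λ i → p (i ↑ˡ n)) +_) (countF-false right≡false)) (+-identityʳ _))

countF-↑ʳ : ∀ m {n} {p : Fin (m + n) → Bool} → (∀ i → p (i ↑ˡ n) ≡ false) →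
            countF p ≡ countF (λ j → p (m ↑ʳ j))
countF-↑ʳ m {n} {p} left≡false = trans (sumF-↑ m _) (cong (_+ countF (λ j → p (m ↑ʳ j))) (countF-false left≡false))

anyF-cong : ∀ {n} {p q : Fin n → Bool} → (∀ i → p i ≡ q i) → anyF p ≡ anyF q
anyF-cong {zero}  p≗q = refl
anyF-cong {suc n} p≗q = cong₂ _∨_ (p≗q zero) (anyF-cong (p≗q ∘ suc))

anyF-false : ∀ {n} {p : Fin n → Bool} → (∀ i → p i ≡ false) → anyF p ≡ false
anyF-false {zero}  p≗false = refl
anyF-false {suc n} p≗false rewrite p≗false zero = anyF-false (p≗false ∘ suc)

anyF-↑ : ∀ m {n} (p : Fin (m + n) → Bool) → anyF p ≡ anyF (λ i → p (i ↑ˡ n)) ∨ anyF (λ j → p (m ↑ʳ j))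
anyF-↑ zero    p = refl
anyF-↑ (suc m) p = trans (cong (p zero ∨_) (anyF-↑ m (p ∘ suc))) (sym (∨-assoc (p zero) _ _))

anyF-↑ˡ : ∀ m {n} {p : Fin (m + n) → Bool} → (∀ j → p (m ↑ʳ j) ≡ false) →
          anyF p ≡ anyF (λ i → p (i ↑ˡ n))
anyF-↑ˡ m {n} {p} right≡false =
  trans (anyF-↑ m _) (trans (cong (anyF (λ i → p (i ↑ˡ n)) ∨_) (anyF-false right≡false)) (∨-identityʳ _))

anyF-↑ʳ : ∀ m {n} {p : Fin (m + n) → Bool} → (∀ i → p (i ↑ˡ n) ≡ false) →
          anyF p ≡ anyF (λ j → p (m ↑ʳ j))
anyF-↑ʳ m {n} {p} left≡false = trans (anyF-↑ m _) (cong (_∨ anyF (λ j → p (m ↑ʳ j))) (anyF-false left≡false))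

-- Floors and ceilings of averages

Near : ℕ → ℕ → Set
Near m x = x ≡ m ⊎ x ≡ suc m

Near⇒≥ : ∀ {m x} → Near m x → m ≤ x
Near⇒≥ (inj₁ refl) = ≤-refl
Near⇒≥ (inj₂ refl) = n≤1+n _

Near⇒≤ : ∀ {m x} → Near m x → x ≤ suc m
Near⇒≤ (inj₁ refl) = n≤1+n _
Near⇒≤ (inj₂ refl) = ≤-refl

Near-+ˡ : ∀ y {m x} → Near m x → Near (y + m) (y + x)
Near-+ˡ y (inj₁ refl) = inj₁ refl
Near-+ˡ y (inj₂ refl) = inj₂ (+-suc y _)

floorDiv-unique : ∀ {S N m} → N * m ≤ S → S < N * suc m → floorDiv S N ≡ m
floorDiv-unique {S} {suc b} {m} lower upper = ≤-antisym
  (<⇒≤pred (m<n*o⇒m/o<n (subst (S <_) (*-comm (suc b) (suc m)) upper)))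
  (subst (_≤ S / suc b) (m*n/n≡m m (suc b)) (/-monoˡ-≤ (suc b) (subst (_≤ S) (*-comm (suc b) m) lower)))

ceilDiv-unique : ∀ {S N m} → N * m < S → S ≤ N * suc m → ceilDiv S N ≡ suc m
ceilDiv-unique {suc S} {zero} _ ()
ceilDiv-unique {S} {suc b} {m} lower upper = ≤-antisym
  (<⇒≤pred (m<n*o⇒m/o<n (begin-strict
    S + b                  <⟨ +-monoʳ-< S (n<1+n b) ⟩
    S + suc b              ≤⟨ +-monoˡ-≤ (suc b) upper ⟩
    suc b * suc m + suc b  ≡⟨ shiftUp b m ⟩
    suc (suc m) * suc b    ∎)))
  (subst (_≤ (S + b) / suc b) (m*n/n≡m (suc m) (suc b)) (/-monoˡ-≤ (suc b) (begin
    suc m * suc b          ≡⟨ shiftDown b m ⟩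
    suc (suc b * m) + b    ≤⟨ +-monoˡ-≤ b lower ⟩
    S + b                  ∎)))
  where
  open ≤-Reasoning
  shiftUp : ∀ b m → suc b * suc m + suc b ≡ suc (suc m) * suc b
  shiftUp = solve-∀
  shiftDown : ∀ b m → suc m * suc b ≡ suc (suc b * m) + b
  shiftDown = solve-∀

sumWhere : ∀ {a b} → (Fin a → Fin b → Bool) → (Fin a → Fin b → ℕ) → ℕ
sumWhere D f = sumF (λ i → sumF (λ j → if D i j then f i j else 0))

module _ {a b} (D : Fin a → Fin b → Bool) where

  private
    if-mono-≤ : ∀ d {x y} → (T d → x ≤ y) → (if d then x else 0) ≤ (if d then y else 0)
    if-mono-≤ true  x≤y = x≤y tt
    if-mono-≤ false _   = z≤n

    if-mono-< : ∀ d {x y} → T d → x < y → (if d then x else 0) < (if d then y else 0)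
    if-mono-< true _ x<y = x<y

    if-*ʳ : ∀ d m → (if d then 1 else 0) * m ≡ (if d then m else 0)
    if-*ʳ true  m = +-identityʳ m
    if-*ʳ false m = refl

  sumWhere-mono-≤ : ∀ {f g} → (∀ i j → T (D i j) → f i j ≤ g i j) → sumWhere D f ≤ sumWhere D g
  sumWhere-mono-≤ f≤g = sumF-mono-≤ (λ i → sumF-mono-≤ (λ j → if-mono-≤ (D i j) (f≤g i j)))

  sumWhere-mono-< : ∀ {f g} → (∀ i j → T (D i j) → f i j ≤ g i j) →
                    ∀ i j → T (D i j) → f i j < g i j → sumWhere D f < sumWhere D g
  sumWhere-mono-< f≤g i j dij fij<gij =
    sumF-mono-< (λ i → sumF-mono-≤ (λ j → if-mono-≤ (D i j) (f≤g i j))) i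
      (sumF-mono-< (λ j → if-mono-≤ (D i j) (f≤g i j)) j (if-mono-< (D i j) dij fij<gij))

  sumWhere-const : ∀ m → sumWhere D (λ _ _ → 1) * m ≡ sumWhere D (λ _ _ → m)
  sumWhere-const m = begin
    sumWhere D (λ _ _ → 1) * m
      ≡⟨ sumF-distribʳ (λ i → sumF (λ j → if D i j then 1 else 0)) m ⟩
    sumF (λ i → sumF (λ j → if D i j then 1 else 0) * m)
      ≡⟨ sumF-cong (λ i → sumF-distribʳ (λ j → if D i j then 1 else 0) m) ⟩
    sumF (λ i → sumF (λ j → (if D i j then 1 else 0) * m))
      ≡⟨ sumF-cong (λ i → sumF-cong (λ j → if-*ʳ (D i j) m)) ⟩
    sumWhere D (λ _ _ → m) ∎
    where open ≡-Reasoning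

  sumWhere-floorOrCeil : ∀ {f m} → (∀ i j → T (D i j) → Near m (f i j)) →
    ∀ i j → T (D i j) → FloorOrCeil (f i j) (sumWhere D f) (sumWhere D (λ _ _ → 1))
  sumWhere-floorOrCeil {f} {m} near i j dij with near i j dij
  ... | inj₁ fij≡m   = inj₁ (trans fij≡m (sym (floorDiv-unique {N = sumWhere D (λ _ _ → 1)} lower strictUpper)))
    where
    lower : sumWhere D (λ _ _ → 1) * m ≤ sumWhere D f
    lower = subst (_≤ _) (sym (sumWhere-const m)) (sumWhere-mono-≤ (λ i j d → Near⇒≥ (near i j d)))
    strictUpper : sumWhere D f < sumWhere D (λ _ _ → 1) * suc m
    strictUpper = subst (_ <_) (sym (sumWhere-const (suc m)))
      (sumWhere-mono-< (λ i j d → Near⇒≤ (near i j d)) i j dij (subst (_< suc m) (sym fij≡m) ≤-refl))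
  ... | inj₂ fij≡1+m = inj₂ (trans fij≡1+m (sym (ceilDiv-unique {N = sumWhere D (λ _ _ → 1)} strictLower upper)))
    where
    upper : sumWhere D f ≤ sumWhere D (λ _ _ → 1) * suc m
    upper = subst (_ ≤_) (sym (sumWhere-const (suc m))) (sumWhere-mono-≤ (λ i j d → Near⇒≤ (near i j d)))
    strictLower : sumWhere D (λ _ _ → 1) * m < sumWhere D f
    strictLower = subst (_< _) (sym (sumWhere-const m))
      (sumWhere-mono-< (λ i j d → Near⇒≥ (near i j d)) i j dij (subst (m <_) (sym fij≡1+m) ≤-refl))

sumWhere-ones : ∀ a b → sumWhere {a} {b} (λ _ _ → true) (λ _ _ → 1) ≡ a * b
sumWhere-ones a b = trans (sumF-cong {a} (λ _ → sumF-ones b)) (sumF-const a b)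

sumF-floorOrCeil : ∀ {n} {f : Fin n → ℕ} {m} → (∀ i → Near m (f i)) → ∀ i → FloorOrCeil (f i) (sumF f) n
sumF-floorOrCeil {n} {f} near i =
  subst₂ (FloorOrCeil (f i)) (+-identityʳ (sumF f)) (trans (+-identityʳ _) (sumF-ones n))
    (sumWhere-floorOrCeil {1} (λ _ _ → true) (λ _ j _ → near j) zero i tt)

ordered : ∀ {n} → Fin n → Fin n → Bool
ordered i j = ⌊ toℕ i <? toℕ j ⌋

ordered-suc : ∀ {n} (i j : Fin n) → ordered (suc i) (suc j) ≡ ordered i j
ordered-suc i j = trans (isYes≗does (suc (toℕ i) <? suc (toℕ j))) (sym (isYes≗does (toℕ i <? toℕ j)))

[1+n]C2≡n+nC2 : ∀ n → suc n C 2 ≡ n + n C 2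
[1+n]C2≡n+nC2 n = trans (sym (nCk+nC[k+1]≡[n+1]C[k+1] n 1)) (cong (_+ n C 2) (nC1≡n n))

sumWhere-ordered-ones : ∀ n → sumWhere {n} ordered (λ _ _ → 1) ≡ n C 2
sumWhere-ordered-ones zero    = refl
sumWhere-ordered-ones (suc n) = begin
  sumF {n} (λ _ → 1) + sumF {n} (λ i → sumF {n} (λ j → if ordered (suc i) (suc j) then 1 else 0))
    ≡⟨ cong₂ _+_ (sumF-ones n) (sumF-cong {n} (λ i → sumF-cong {n} (λ j →
         cong (λ d → if d then 1 else 0) (ordered-suc i j)))) ⟩
  n + sumWhere {n} ordered (λ _ _ → 1)
    ≡⟨ cong (n +_) (sumWhere-ordered-ones n) ⟩
  n + n C 2
    ≡⟨ [1+n]C2≡n+nC2 n ⟨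
  suc n C 2 ∎
  where open ≡-Reasoning

pairSum-floorOrCeil : ∀ {n} (f : Fin n → Fin n → ℕ) {m} → (∀ i j → f i j ≡ f j i) →
  (∀ i j → i ≢ j → Near m (f i j)) → ∀ i j → i ≢ j → FloorOrCeil (f i j) (sumWhere ordered f) (n C 2)
pairSum-floorOrCeil {n} f f-comm near i j i≢j =
  subst (FloorOrCeil (f i j) (sumWhere ordered f)) (sumWhere-ordered-ones n) (unordered i j i≢j)
  where
  FloorOrCeil′ : ℕ → Set
  FloorOrCeil′ x = FloorOrCeil x (sumWhere ordered f) (sumWhere {n} ordered (λ _ _ → 1))
  inOrder : ∀ i j → T (ordered i j) → FloorOrCeil′ (f i j)
  inOrder = sumWhere-floorOrCeil ordered (λ i j i<j → near i j (λ { refl → <-irrefl refl (toWitness i<j) }))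
  unordered : ∀ i j → i ≢ j → FloorOrCeil′ (f i j)
  unordered i j i≢j with <-cmp i j
  ... | tri< i<j _ _ = inOrder i j (fromWitness i<j)
  ... | tri≈ _ i≡j _ = ⊥-elim (i≢j i≡j)
  ... | tri> _ _ j<i = subst FloorOrCeil′ (f-comm j i) (inOrder j i (fromWitness j<i))

-- Designs whose statistics take two consecutive values

record WithinOne {r c v} (A : Design r c v) (e λrc λrr λcc : ℕ) : Set where
  field
    binary           : Binary A
    replication-near : ∀ s → Near e (replication A s)
    rowCol-near      : ∀ i j → Near λrc (rowCol A i j)
    rowRow-near      : ∀ i i′ → i ≢ i′ → Near λrr (rowRow A i i′)
    colCol-near      : ∀ j j′ → j ≢ j′ → Near λcc (colCol A j j′)

module _ {r c v} (A : Design r c v) where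

  sumF-replication : sumF (replication A) ≡ r * c
  sumF-replication = begin
    sumF (λ s → sumF (λ i → sumF (λ j → occurs i j s)))
      ≡⟨ sumF-comm (λ s i → sumF (λ j → occurs i j s)) ⟩
    sumF (λ i → sumF (λ s → sumF (λ j → occurs i j s)))
      ≡⟨ sumF-cong (λ i → sumF-comm (λ s j → occurs i j s)) ⟩
    sumF (λ i → sumF (λ j → countF (λ s → ⌊ A i j ≟ s ⌋)))
      ≡⟨ sumF-cong (λ i → sumF-cong (λ j → countF-≟ (A i j))) ⟩
    sumWhere {r} {c} (λ _ _ → true) (λ _ _ → 1)
      ≡⟨ sumWhere-ones r c ⟩
    r * c ∎
    where
    open ≡-Reasoning
    occurs : Fin r → Fin c → Fin v → ℕ
    occurs i j s = if ⌊ A i j ≟ s ⌋ then 1 else 0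

  rowRow-comm : ∀ i i′ → rowRow A i i′ ≡ rowRow A i′ i
  rowRow-comm i i′ = countF-cong (λ s → ∧-comm (inRow A i s) (inRow A i′ s))

  colCol-comm : ∀ j j′ → colCol A j j′ ≡ colCol A j′ j
  colCol-comm j j′ = countF-cong (λ s → ∧-comm (inCol A j s) (inCol A j′ s))

  equireplicate⊎near : (∀ s → FloorOrCeil (replication A s) (r * c) v) → Equireplicate A ⊎ NearEquireplicate A
  equireplicate⊎near replications with floorDiv (r * c) v ≟ℕ ceilDiv (r * c) v
  ... | yes e⁻≡e⁺ = inj₁ (e⁻≡e⁺ , λ s → [ id , (λ rep≡e⁺ → trans rep≡e⁺ (sym e⁻≡e⁺)) ]′ (replications s))
  ... | no e⁻≢e⁺  = inj₂ (e⁻≢e⁺ , replications)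

nearTripleArray : ∀ {r c v} {A : Design r c v} {e λrc λrr λcc} → WithinOne A e λrc λrr λcc → NearTripleArrayProp A
nearTripleArray {r} {c} {v} {A} w =
    binary
  , equireplicate⊎near A (λ s → subst (λ S → FloorOrCeil (replication A s) S v) (sumF-replication A)
                                      (sumF-floorOrCeil replication-near s))
  , (λ i j → subst (FloorOrCeil (rowCol A i j) (sumRC A)) (sumWhere-ones r c)
               (sumWhere-floorOrCeil (λ _ _ → true) (λ i j _ → rowCol-near i j) i j tt))
  , pairSum-floorOrCeil (rowRow A) (rowRow-comm A) rowRow-near
  , pairSum-floorOrCeil (colCol A) (colCol-comm A) colCol-near
  where open WithinOne w

-- Juxtaposition of designs on disjoint symbol sets

data SplitView (m n : ℕ) : Fin (m + n) → Set where
  left  : ∀ i → SplitView m n (i ↑ˡ n)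
  right : ∀ j → SplitView m n (m ↑ʳ j)

splitView : ∀ m n k → SplitView m n k
splitView zero    n k       = right k
splitView (suc m) n zero    = left zero
splitView (suc m) n (suc k) with splitView m n k
... | left i  = left (suc i)
... | right j = right j

↑ˡ≢↑ʳ : ∀ {m n} (i : Fin m) (j : Fin n) → i ↑ˡ n ≢ m ↑ʳ j
↑ˡ≢↑ʳ zero    j ()
↑ˡ≢↑ʳ (suc i) j eq = ↑ˡ≢↑ʳ i j (suc-injective eq)

≟-injective : ∀ {m n} (f : Fin m → Fin n) → (∀ {x y} → f x ≡ f y → x ≡ y) → ∀ x y → ⌊ f x ≟ f y ⌋ ≡ ⌊ x ≟ y ⌋
≟-injective f f-inj x y with f x ≟ f y | x ≟ y
... | yes _     | yes _   = refl
... | no _      | no _    = refl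
... | yes fx≡fy | no x≢y  = ⊥-elim (x≢y (f-inj fx≡fy))
... | no fx≢fy  | yes x≡y = ⊥-elim (fx≢fy (cong f x≡y))

≟-≢ : ∀ {n} {x y : Fin n} → x ≢ y → ⌊ x ≟ y ⌋ ≡ false
≟-≢ {x = x} {y} x≢y = trans (isYes≗does (x ≟ y)) (dec-false (x ≟ y) x≢y)

_∥_ : ∀ {r c₁ v₁ c₂ v₂} → Design r c₁ v₁ → Design r c₂ v₂ → Design r (c₁ + c₂) (v₁ + v₂)
_∥_ {c₁ = c₁} {v₁} {v₂ = v₂} A B i j = [ (λ j₁ → A i j₁ ↑ˡ v₂) , (λ j₂ → v₁ ↑ʳ B i j₂) ]′ (splitAt c₁ j)

module Juxtaposition {r c₁ v₁ c₂ v₂} (A : Design r c₁ v₁) (B : Design r c₂ v₂) where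

  ∥-left : ∀ i j → (A ∥ B) i (j ↑ˡ c₂) ≡ A i j ↑ˡ v₂
  ∥-left i j rewrite splitAt-↑ˡ c₁ j c₂ = refl

  ∥-right : ∀ i j → (A ∥ B) i (c₁ ↑ʳ j) ≡ v₁ ↑ʳ B i j
  ∥-right i j rewrite splitAt-↑ʳ c₁ c₂ j = refl

  occurs-ll : ∀ i j s → ⌊ (A ∥ B) i (j ↑ˡ c₂) ≟ s ↑ˡ v₂ ⌋ ≡ ⌊ A i j ≟ s ⌋
  occurs-ll i j s rewrite ∥-left i j = ≟-injective (_↑ˡ v₂) (↑ˡ-injective v₂ _ _) (A i j) s

  occurs-lr : ∀ i j s → ⌊ (A ∥ B) i (j ↑ˡ c₂) ≟ v₁ ↑ʳ s ⌋ ≡ false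
  occurs-lr i j s rewrite ∥-left i j = ≟-≢ (↑ˡ≢↑ʳ (A i j) s)

  occurs-rl : ∀ i j s → ⌊ (A ∥ B) i (c₁ ↑ʳ j) ≟ s ↑ˡ v₂ ⌋ ≡ false
  occurs-rl i j s rewrite ∥-right i j = ≟-≢ (↑ˡ≢↑ʳ s (B i j) ∘ sym)

  occurs-rr : ∀ i j s → ⌊ (A ∥ B) i (c₁ ↑ʳ j) ≟ v₁ ↑ʳ s ⌋ ≡ ⌊ B i j ≟ s ⌋
  occurs-rr i j s rewrite ∥-right i j = ≟-injective (v₁ ↑ʳ_) (↑ʳ-injective v₁ _ _) (B i j) s

  inRow-left : ∀ i s → inRow (A ∥ B) i (s ↑ˡ v₂) ≡ inRow A i s
  inRow-left i s = trans (anyF-↑ˡ c₁ (λ j → occurs-rl i j s)) (anyF-cong (λ j → occurs-ll i j s))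

  inRow-right : ∀ i s → inRow (A ∥ B) i (v₁ ↑ʳ s) ≡ inRow B i s
  inRow-right i s = trans (anyF-↑ʳ c₁ (λ j → occurs-lr i j s)) (anyF-cong (λ j → occurs-rr i j s))

  inCol-ll : ∀ j s → inCol (A ∥ B) (j ↑ˡ c₂) (s ↑ˡ v₂) ≡ inCol A j s
  inCol-ll j s = anyF-cong (λ i → occurs-ll i j s)

  inCol-lr : ∀ j s → inCol (A ∥ B) (j ↑ˡ c₂) (v₁ ↑ʳ s) ≡ false
  inCol-lr j s = anyF-false (λ i → occurs-lr i j s)

  inCol-rl : ∀ j s → inCol (A ∥ B) (c₁ ↑ʳ j) (s ↑ˡ v₂) ≡ false
  inCol-rl j s = anyF-false (λ i → occurs-rl i j s)

  inCol-rr : ∀ j s → inCol (A ∥ B) (c₁ ↑ʳ j) (v₁ ↑ʳ s) ≡ inCol B j s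
  inCol-rr j s = anyF-cong (λ i → occurs-rr i j s)

  replication-left : ∀ s → replication (A ∥ B) (s ↑ˡ v₂) ≡ replication A s
  replication-left s = sumF-cong (λ i →
    trans (countF-↑ˡ c₁ (λ j → occurs-rl i j s)) (countF-cong (λ j → occurs-ll i j s)))

  replication-right : ∀ s → replication (A ∥ B) (v₁ ↑ʳ s) ≡ replication B s
  replication-right s = sumF-cong (λ i →
    trans (countF-↑ʳ c₁ (λ j → occurs-lr i j s)) (countF-cong (λ j → occurs-rr i j s)))

  rowCol-left : ∀ i j → rowCol (A ∥ B) i (j ↑ˡ c₂) ≡ rowCol A i j
  rowCol-left i j = trans (countF-↑ˡ v₁ (λ s → trans (cong (_ ∧_) (inCol-lr j s)) (∧-zeroʳ _)))
                          (countF-cong (λ s → cong₂ _∧_ (inRow-left i s) (inCol-ll j s)))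

  rowCol-right : ∀ i j → rowCol (A ∥ B) i (c₁ ↑ʳ j) ≡ rowCol B i j
  rowCol-right i j = trans (countF-↑ʳ v₁ (λ s → trans (cong (_ ∧_) (inCol-rl j s)) (∧-zeroʳ _)))
                           (countF-cong (λ s → cong₂ _∧_ (inRow-right i s) (inCol-rr j s)))

  rowRow-∥ : ∀ i i′ → rowRow (A ∥ B) i i′ ≡ rowRow A i i′ + rowRow B i i′
  rowRow-∥ i i′ = trans (sumF-↑ v₁ _)
    (cong₂ _+_ (countF-cong (λ s → cong₂ _∧_ (inRow-left i s) (inRow-left i′ s)))
               (countF-cong (λ s → cong₂ _∧_ (inRow-right i s) (inRow-right i′ s))))

  colCol-ll : ∀ j j′ → colCol (A ∥ B) (j ↑ˡ c₂) (j′ ↑ˡ c₂) ≡ colCol A j j′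
  colCol-ll j j′ = trans (countF-↑ˡ v₁ (λ s → trans (cong (_ ∧_) (inCol-lr j′ s)) (∧-zeroʳ _)))
                         (countF-cong (λ s → cong₂ _∧_ (inCol-ll j s) (inCol-ll j′ s)))

  colCol-rr : ∀ j j′ → colCol (A ∥ B) (c₁ ↑ʳ j) (c₁ ↑ʳ j′) ≡ colCol B j j′
  colCol-rr j j′ = trans (countF-↑ʳ v₁ (λ s → trans (cong (_ ∧_) (inCol-rl j′ s)) (∧-zeroʳ _)))
                         (countF-cong (λ s → cong₂ _∧_ (inCol-rr j s) (inCol-rr j′ s)))

  colCol-lr : ∀ j j′ → colCol (A ∥ B) (j ↑ˡ c₂) (c₁ ↑ʳ j′) ≡ 0
  colCol-lr j j′ = trans (sumF-↑ v₁ _)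
    (cong₂ _+_ (countF-false (λ s → trans (cong (_ ∧_) (inCol-rl j′ s)) (∧-zeroʳ _)))
               (countF-false (λ s → cong (_∧ _) (inCol-lr j s))))

  ∥-binary : Binary A → Binary B → Binary (A ∥ B)
  ∥-binary (rowsA , colsA) (rowsB , colsB) = rows , cols
    where
    rows : ∀ i j j′ → (A ∥ B) i j ≡ (A ∥ B) i j′ → j ≡ j′
    rows i j j′ eq with splitView c₁ c₂ j | splitView c₁ c₂ j′
    ... | left a  | left b  =
      cong (_↑ˡ c₂) (rowsA i a b (↑ˡ-injective v₂ _ _ (trans (sym (∥-left i a)) (trans eq (∥-left i b)))))
    ... | left a  | right b = ⊥-elim (↑ˡ≢↑ʳ (A i a) (B i b) (trans (sym (∥-left i a)) (trans eq (∥-right i b))))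
    ... | right a | left b  = ⊥-elim (↑ˡ≢↑ʳ (A i b) (B i a) (trans (sym (∥-left i b)) (trans (sym eq) (∥-right i a))))
    ... | right a | right b =
      cong (c₁ ↑ʳ_) (rowsB i a b (↑ʳ-injective v₁ _ _ (trans (sym (∥-right i a)) (trans eq (∥-right i b)))))
    cols : ∀ i i′ j → (A ∥ B) i j ≡ (A ∥ B) i′ j → i ≡ i′
    cols i i′ j eq with splitView c₁ c₂ j
    ... | left a  = colsA i i′ a (↑ˡ-injective v₂ _ _ (trans (sym (∥-left i a)) (trans eq (∥-left i′ a))))
    ... | right a = colsB i i′ a (↑ʳ-injective v₁ _ _ (trans (sym (∥-right i a)) (trans eq (∥-right i′ a))))

  ∥-withinOne : ∀ {e λrc y ρ} → WithinOne A e λrc y 0 → (∀ i i′ → i ≢ i′ → rowRow A i i′ ≡ y) →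
                WithinOne B e λrc ρ 0 → WithinOne (A ∥ B) e λrc (y + ρ) 0
  ∥-withinOne {e} {λrc} {y} {ρ} wA rowRowA≡y wB = record
    { binary           = ∥-binary A.binary B.binary
    ; replication-near = replication-near
    ; rowCol-near      = rowCol-near
    ; rowRow-near      = rowRow-near
    ; colCol-near      = colCol-near
    }
    where
    module A = WithinOne wA
    module B = WithinOne wB

    replication-near : ∀ s → Near e (replication (A ∥ B) s)
    replication-near s with splitView v₁ v₂ s
    ... | left s′  rewrite replication-left s′  = A.replication-near s′
    ... | right s′ rewrite replication-right s′ = B.replication-near s′

    rowCol-near : ∀ i j → Near λrc (rowCol (A ∥ B) i j)
    rowCol-near i j with splitView c₁ c₂ j
    ... | left j′  rewrite rowCol-left i j′  = A.rowCol-near i j′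
    ... | right j′ rewrite rowCol-right i j′ = B.rowCol-near i j′

    rowRow-near : ∀ i i′ → i ≢ i′ → Near (y + ρ) (rowRow (A ∥ B) i i′)
    rowRow-near i i′ i≢i′ rewrite rowRow-∥ i i′ | rowRowA≡y i i′ i≢i′ = Near-+ˡ y (B.rowRow-near i i′ i≢i′)

    colCol-near : ∀ j j′ → j ≢ j′ → Near 0 (colCol (A ∥ B) j j′)
    colCol-near j j′ j≢j′ with splitView c₁ c₂ j | splitView c₁ c₂ j′
    ... | left a  | left b  rewrite colCol-ll a b = A.colCol-near a b (j≢j′ ∘ cong (_↑ˡ c₂))
    ... | left a  | right b rewrite colCol-lr a b = inj₁ refl
    ... | right a | left b  rewrite colCol-comm (A ∥ B) (c₁ ↑ʳ a) (b ↑ˡ c₂) | colCol-lr b a = inj₁ refl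
    ... | right a | right b rewrite colCol-rr a b = B.colCol-near a b (j≢j′ ∘ cong (c₁ ↑ʳ_))

-- Deciding the statistics of a concrete design

near? : ∀ m x → Dec (Near m x)
near? m x = (x ≟ℕ m) ⊎-dec (x ≟ℕ suc m)

binary? : ∀ {r c v} (A : Design r c v) → Dec (Binary A)
binary? A = (all? λ i → all? λ j → all? λ j′ → (A i j ≟ A i j′) →-dec (j ≟ j′))
      ×-dec (all? λ i → all? λ i′ → all? λ j → (A i j ≟ A i′ j) →-dec (i ≟ i′))

withinOne? : ∀ {r c v} (A : Design r c v) e λrc λrr λcc → Dec (WithinOne A e λrc λrr λcc)
withinOne? A e λrc λrr λcc =
  map′ (λ (b , rep , rc , rr , cc) → record
         { binary = b ; replication-near = rep ; rowCol-near = rc ; rowRow-near = rr ; colCol-near = cc })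
       (λ w → let open WithinOne w in binary , replication-near , rowCol-near , rowRow-near , colCol-near)
       (     binary? A
       ×-dec all? (λ s → near? e (replication A s))
       ×-dec all? (λ i → all? λ j → near? λrc (rowCol A i j))
       ×-dec all? (λ i → all? λ i′ → ¬? (i ≟ i′) →-dec near? λrr (rowRow A i i′))
       ×-dec all? (λ j → all? λ j′ → ¬? (j ≟ j′) →-dec near? λcc (colCol A j j′)))

RowRegular : ∀ {r c v} → Design r c v → ℕ → Set
RowRegular A y = ∀ i i′ → i ≢ i′ → rowRow A i i′ ≡ y

rowRegular? : ∀ {r c v} (A : Design r c v) y → Dec (RowRegular A y)
rowRegular? A y = all? λ i → all? λ i′ → ¬? (i ≟ i′) →-dec (rowRow A i i′ ≟ℕ y)

e⁻ : ∀ {r c v} → Design r c v → ℕ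
e⁻ {r} {c} {v} _ = floorDiv (r * c) v

λrc⁻ : ∀ {r c v} → Design r c v → ℕ
λrc⁻ {r} {c} A = floorDiv (sumRC A) (r * c)

λrr⁻ : ∀ {r c v} → Design r c v → ℕ
λrr⁻ {r} A = floorDiv (sumRR A) (r C 2)

λcc⁻ : ∀ {r c v} → Design r c v → ℕ
λcc⁻ {c = c} A = floorDiv (sumCC A) (c C 2)

-- Balanced arrays and regular blocks

record BalancedArray (e λrc c v : ℕ) : Set where
  constructor balancedArray
  field
    {λrr}     : ℕ
    array     : Design 3 c v
    withinOne : WithinOne array e λrc λrr 0

record RegularBlock (e λrc c v : ℕ) : Set where
  field
    block      : Design 3 c v
    λrr        : ℕ
    withinOne  : WithinOne block e λrc λrr 0
    rowRegular : RowRegular block λrr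

regularBlock : ∀ {e λrc c v} (B : Design 3 c v) λrr {_ : True (withinOne? B e λrc λrr 0 ×-dec rowRegular? B λrr)} →
               RegularBlock e λrc c v
regularBlock B λrr {ok} =
  record { block = B ; λrr = λrr ; withinOne = proj₁ (toWitness ok) ; rowRegular = proj₂ (toWitness ok) }

extend : ∀ {e λrc c₀ v₀ c v} → RegularBlock e λrc c₀ v₀ → BalancedArray e λrc c v →
         BalancedArray e λrc (c₀ + c) (v₀ + v)
extend P (balancedArray A wA) = balancedArray (block ∥ A) (Juxtaposition.∥-withinOne block A withinOne rowRegular wA)
  where open RegularBlock P

toNearTripleArray : ∀ {e λrc c v} → BalancedArray e λrc c v → NearTripleArray 3 c v
toNearTripleArray (balancedArray A w) = record { array = A ; isNTA = nearTripleArray w }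

BalancedEntry : ∀ e λrc {c v} → Maybe (Design 3 c v) → Set
BalancedEntry e λrc = Any (λ A → WithinOne A e λrc (λrr⁻ A) 0)

fromEntry : ∀ {e λrc c v} {entry : Maybe (Design 3 c v)} → BalancedEntry e λrc entry → BalancedArray e λrc c v
fromEntry (just w) = balancedArray _ w

-- ≤⇒≤″ would do, but matching its result against refl makes Agda normalise a large proof term.
≤-offset : ∀ {m n} → m ≤ n → ∃ λ k → m + k ≡ n
≤-offset {n = n} z≤n = n , refl
≤-offset (s≤s m≤n) with ≤-offset m≤n
... | k , refl = k , refl

fromRows : ∀ {r c v} → Vec (Vec (Fin v) c) r → Design r c v
fromRows rows i j = lookup (lookup rows i) j

oneColumn : Design 3 1 3
oneColumn i _ = i

sixColumns : Design 3 6 9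
sixColumns = fromRows
  ( (# 6 ∷ # 0 ∷ # 1 ∷ # 3 ∷ # 5 ∷ # 7 ∷ [])
  ∷ (# 1 ∷ # 5 ∷ # 4 ∷ # 7 ∷ # 8 ∷ # 2 ∷ [])
  ∷ (# 8 ∷ # 2 ∷ # 0 ∷ # 4 ∷ # 3 ∷ # 6 ∷ [])
  ∷ [])

-- Its columns are the lines of the Fano plane.
fano : Design 3 7 7
fano = fromRows
  ( (# 2 ∷ # 4 ∷ # 5 ∷ # 3 ∷ # 6 ∷ # 0 ∷ # 1 ∷ [])
  ∷ (# 4 ∷ # 3 ∷ # 2 ∷ # 6 ∷ # 1 ∷ # 5 ∷ # 0 ∷ [])
  ∷ (# 6 ∷ # 1 ∷ # 3 ∷ # 0 ∷ # 5 ∷ # 4 ∷ # 2 ∷ [])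
  ∷ [])

-- v ≥ 3c

emptyWithinOne : ∀ {v} → WithinOne {3} {0} {v} (λ _ ()) 0 1 0 0
emptyWithinOne {v} = record
  { binary           = (λ _ ()) , (λ _ _ ())
  ; replication-near = λ _ → inj₁ refl
  ; rowCol-near      = λ _ ()
  ; rowRow-near      = λ _ _ _ → inj₁ (countF-false {v} (λ _ → refl))
  ; colCol-near      = λ ()
  }

sparseArray : ∀ c d → BalancedArray 0 1 c (c * 3 + d)
sparseArray zero    d = balancedArray (λ _ ()) emptyWithinOne
sparseArray (suc c) d = extend (regularBlock oneColumn 0) (sparseArray c d)

-- c ≤ v ≤ 3c/2

denseTable : (c t : ℕ) → Maybe (Design 3 c (c + t))
denseTable 8 0 = just (fromRows
  ( (# 5 ∷ # 1 ∷ # 2 ∷ # 7 ∷ # 4 ∷ # 6 ∷ # 0 ∷ # 3 ∷ [])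
  ∷ (# 7 ∷ # 5 ∷ # 6 ∷ # 1 ∷ # 2 ∷ # 0 ∷ # 3 ∷ # 4 ∷ [])
  ∷ (# 3 ∷ # 4 ∷ # 5 ∷ # 2 ∷ # 0 ∷ # 7 ∷ # 1 ∷ # 6 ∷ [])
  ∷ []))
denseTable 8 1 = just (fromRows
  ( (# 3 ∷ # 2 ∷ # 7 ∷ # 0 ∷ # 5 ∷ # 4 ∷ # 6 ∷ # 1 ∷ [])
  ∷ (# 0 ∷ # 3 ∷ # 6 ∷ # 1 ∷ # 8 ∷ # 2 ∷ # 4 ∷ # 5 ∷ [])
  ∷ (# 5 ∷ # 1 ∷ # 2 ∷ # 8 ∷ # 7 ∷ # 0 ∷ # 3 ∷ # 4 ∷ [])
  ∷ []))
denseTable 8 2 = just (fromRows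
  ( (# 0 ∷ # 2 ∷ # 5 ∷ # 3 ∷ # 7 ∷ # 8 ∷ # 9 ∷ # 1 ∷ [])
  ∷ (# 5 ∷ # 3 ∷ # 4 ∷ # 0 ∷ # 2 ∷ # 1 ∷ # 6 ∷ # 9 ∷ [])
  ∷ (# 8 ∷ # 4 ∷ # 1 ∷ # 6 ∷ # 0 ∷ # 3 ∷ # 7 ∷ # 2 ∷ [])
  ∷ []))
denseTable 8 3 = just (fromRows
  ( (# 8 ∷ # 9 ∷ # 0 ∷ # 1 ∷ # 10 ∷ # 2 ∷ # 5 ∷ # 4 ∷ [])
  ∷ (# 3 ∷ # 5 ∷ # 8 ∷ # 7 ∷ # 4 ∷ # 6 ∷ # 1 ∷ # 0 ∷ [])
  ∷ (# 2 ∷ # 7 ∷ # 6 ∷ # 0 ∷ # 3 ∷ # 1 ∷ # 10 ∷ # 9 ∷ [])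
  ∷ []))
denseTable 8 4 = just (fromRows
  ( (# 5 ∷ # 3 ∷ # 10 ∷ # 6 ∷ # 8 ∷ # 1 ∷ # 11 ∷ # 4 ∷ [])
  ∷ (# 7 ∷ # 9 ∷ # 0 ∷ # 4 ∷ # 10 ∷ # 5 ∷ # 3 ∷ # 2 ∷ [])
  ∷ (# 6 ∷ # 8 ∷ # 11 ∷ # 9 ∷ # 2 ∷ # 0 ∷ # 7 ∷ # 1 ∷ [])
  ∷ []))
denseTable 9 0 = just (fromRows
  ( (# 4 ∷ # 5 ∷ # 8 ∷ # 1 ∷ # 2 ∷ # 7 ∷ # 6 ∷ # 0 ∷ # 3 ∷ [])
  ∷ (# 3 ∷ # 7 ∷ # 4 ∷ # 0 ∷ # 8 ∷ # 6 ∷ # 1 ∷ # 2 ∷ # 5 ∷ [])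
  ∷ (# 6 ∷ # 1 ∷ # 5 ∷ # 3 ∷ # 7 ∷ # 0 ∷ # 8 ∷ # 4 ∷ # 2 ∷ [])
  ∷ []))
denseTable 9 1 = just (fromRows
  ( (# 4 ∷ # 5 ∷ # 0 ∷ # 6 ∷ # 2 ∷ # 3 ∷ # 7 ∷ # 9 ∷ # 1 ∷ [])
  ∷ (# 8 ∷ # 0 ∷ # 6 ∷ # 4 ∷ # 9 ∷ # 1 ∷ # 5 ∷ # 3 ∷ # 2 ∷ [])
  ∷ (# 0 ∷ # 2 ∷ # 1 ∷ # 3 ∷ # 6 ∷ # 5 ∷ # 4 ∷ # 7 ∷ # 8 ∷ [])
  ∷ []))
denseTable 9 2 = just (fromRows
  ( (# 4 ∷ # 10 ∷ # 5 ∷ # 2 ∷ # 8 ∷ # 7 ∷ # 3 ∷ # 0 ∷ # 1 ∷ [])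
  ∷ (# 1 ∷ # 2 ∷ # 3 ∷ # 7 ∷ # 6 ∷ # 0 ∷ # 9 ∷ # 4 ∷ # 5 ∷ [])
  ∷ (# 10 ∷ # 9 ∷ # 4 ∷ # 6 ∷ # 3 ∷ # 8 ∷ # 1 ∷ # 2 ∷ # 0 ∷ [])
  ∷ []))
denseTable 9 3 = just (fromRows
  ( (# 9 ∷ # 1 ∷ # 2 ∷ # 6 ∷ # 10 ∷ # 3 ∷ # 7 ∷ # 0 ∷ # 11 ∷ [])
  ∷ (# 7 ∷ # 3 ∷ # 0 ∷ # 2 ∷ # 6 ∷ # 4 ∷ # 1 ∷ # 5 ∷ # 8 ∷ [])
  ∷ (# 2 ∷ # 9 ∷ # 10 ∷ # 8 ∷ # 5 ∷ # 0 ∷ # 4 ∷ # 11 ∷ # 1 ∷ [])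
  ∷ []))
denseTable 9 4 = just (fromRows
  ( (# 7 ∷ # 10 ∷ # 8 ∷ # 5 ∷ # 0 ∷ # 3 ∷ # 12 ∷ # 2 ∷ # 6 ∷ [])
  ∷ (# 0 ∷ # 1 ∷ # 9 ∷ # 6 ∷ # 8 ∷ # 12 ∷ # 11 ∷ # 10 ∷ # 4 ∷ [])
  ∷ (# 1 ∷ # 5 ∷ # 3 ∷ # 11 ∷ # 2 ∷ # 4 ∷ # 7 ∷ # 9 ∷ # 0 ∷ [])
  ∷ []))
denseTable 10 0 = just (fromRows
  ( (# 0 ∷ # 7 ∷ # 9 ∷ # 3 ∷ # 8 ∷ # 2 ∷ # 1 ∷ # 6 ∷ # 5 ∷ # 4 ∷ [])
  ∷ (# 9 ∷ # 4 ∷ # 8 ∷ # 2 ∷ # 5 ∷ # 0 ∷ # 7 ∷ # 3 ∷ # 1 ∷ # 6 ∷ [])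
  ∷ (# 5 ∷ # 8 ∷ # 6 ∷ # 7 ∷ # 3 ∷ # 1 ∷ # 9 ∷ # 0 ∷ # 4 ∷ # 2 ∷ [])
  ∷ []))
denseTable 10 1 = just (fromRows
  ( (# 7 ∷ # 2 ∷ # 5 ∷ # 8 ∷ # 9 ∷ # 4 ∷ # 1 ∷ # 3 ∷ # 6 ∷ # 0 ∷ [])
  ∷ (# 2 ∷ # 1 ∷ # 7 ∷ # 4 ∷ # 10 ∷ # 3 ∷ # 6 ∷ # 0 ∷ # 5 ∷ # 8 ∷ [])
  ∷ (# 6 ∷ # 0 ∷ # 10 ∷ # 2 ∷ # 1 ∷ # 9 ∷ # 3 ∷ # 5 ∷ # 4 ∷ # 7 ∷ [])
  ∷ []))
denseTable 10 2 = just (fromRows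
  ( (# 4 ∷ # 9 ∷ # 11 ∷ # 5 ∷ # 3 ∷ # 0 ∷ # 2 ∷ # 1 ∷ # 8 ∷ # 7 ∷ [])
  ∷ (# 0 ∷ # 11 ∷ # 1 ∷ # 6 ∷ # 5 ∷ # 10 ∷ # 7 ∷ # 2 ∷ # 3 ∷ # 4 ∷ [])
  ∷ (# 6 ∷ # 0 ∷ # 4 ∷ # 2 ∷ # 9 ∷ # 5 ∷ # 8 ∷ # 10 ∷ # 1 ∷ # 3 ∷ [])
  ∷ []))
denseTable 10 3 = just (fromRows
  ( (# 7 ∷ # 3 ∷ # 12 ∷ # 1 ∷ # 2 ∷ # 0 ∷ # 6 ∷ # 8 ∷ # 11 ∷ # 5 ∷ [])
  ∷ (# 4 ∷ # 10 ∷ # 9 ∷ # 12 ∷ # 8 ∷ # 3 ∷ # 7 ∷ # 1 ∷ # 2 ∷ # 0 ∷ [])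
  ∷ (# 1 ∷ # 11 ∷ # 6 ∷ # 5 ∷ # 3 ∷ # 4 ∷ # 10 ∷ # 0 ∷ # 9 ∷ # 2 ∷ [])
  ∷ []))
denseTable 10 4 = just (fromRows
  ( (# 4 ∷ # 12 ∷ # 2 ∷ # 6 ∷ # 7 ∷ # 8 ∷ # 0 ∷ # 5 ∷ # 1 ∷ # 13 ∷ [])
  ∷ (# 11 ∷ # 9 ∷ # 4 ∷ # 1 ∷ # 0 ∷ # 10 ∷ # 8 ∷ # 6 ∷ # 3 ∷ # 7 ∷ [])
  ∷ (# 1 ∷ # 0 ∷ # 3 ∷ # 2 ∷ # 10 ∷ # 12 ∷ # 13 ∷ # 11 ∷ # 5 ∷ # 9 ∷ [])
  ∷ []))
denseTable 10 5 = just (fromRows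
  ( (# 0 ∷ # 9 ∷ # 14 ∷ # 6 ∷ # 12 ∷ # 13 ∷ # 3 ∷ # 2 ∷ # 11 ∷ # 10 ∷ [])
  ∷ (# 6 ∷ # 3 ∷ # 5 ∷ # 4 ∷ # 13 ∷ # 7 ∷ # 1 ∷ # 8 ∷ # 14 ∷ # 2 ∷ [])
  ∷ (# 7 ∷ # 8 ∷ # 12 ∷ # 9 ∷ # 1 ∷ # 10 ∷ # 11 ∷ # 0 ∷ # 4 ∷ # 5 ∷ [])
  ∷ []))
denseTable 11 0 = just (fromRows
  ( (# 3 ∷ # 5 ∷ # 9 ∷ # 2 ∷ # 7 ∷ # 1 ∷ # 4 ∷ # 6 ∷ # 0 ∷ # 8 ∷ # 10 ∷ [])
  ∷ (# 1 ∷ # 9 ∷ # 10 ∷ # 7 ∷ # 0 ∷ # 8 ∷ # 2 ∷ # 3 ∷ # 6 ∷ # 4 ∷ # 5 ∷ [])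
  ∷ (# 7 ∷ # 2 ∷ # 0 ∷ # 6 ∷ # 8 ∷ # 9 ∷ # 10 ∷ # 5 ∷ # 4 ∷ # 3 ∷ # 1 ∷ [])
  ∷ []))
denseTable 11 1 = just (fromRows
  ( (# 1 ∷ # 8 ∷ # 6 ∷ # 10 ∷ # 11 ∷ # 2 ∷ # 4 ∷ # 0 ∷ # 5 ∷ # 3 ∷ # 7 ∷ [])
  ∷ (# 7 ∷ # 0 ∷ # 4 ∷ # 2 ∷ # 6 ∷ # 9 ∷ # 5 ∷ # 11 ∷ # 8 ∷ # 1 ∷ # 3 ∷ [])
  ∷ (# 6 ∷ # 10 ∷ # 3 ∷ # 4 ∷ # 2 ∷ # 5 ∷ # 7 ∷ # 9 ∷ # 1 ∷ # 0 ∷ # 8 ∷ [])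
  ∷ []))
denseTable 11 2 = just (fromRows
  ( (# 12 ∷ # 3 ∷ # 7 ∷ # 8 ∷ # 1 ∷ # 5 ∷ # 10 ∷ # 6 ∷ # 4 ∷ # 0 ∷ # 2 ∷ [])
  ∷ (# 3 ∷ # 4 ∷ # 2 ∷ # 1 ∷ # 5 ∷ # 11 ∷ # 6 ∷ # 8 ∷ # 9 ∷ # 12 ∷ # 0 ∷ [])
  ∷ (# 5 ∷ # 2 ∷ # 6 ∷ # 3 ∷ # 0 ∷ # 7 ∷ # 1 ∷ # 4 ∷ # 10 ∷ # 9 ∷ # 11 ∷ [])
  ∷ []))
denseTable 11 3 = just (fromRows
  ( (# 11 ∷ # 2 ∷ # 9 ∷ # 5 ∷ # 4 ∷ # 1 ∷ # 13 ∷ # 3 ∷ # 0 ∷ # 10 ∷ # 8 ∷ [])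
  ∷ (# 13 ∷ # 1 ∷ # 7 ∷ # 4 ∷ # 12 ∷ # 6 ∷ # 0 ∷ # 2 ∷ # 9 ∷ # 3 ∷ # 5 ∷ [])
  ∷ (# 3 ∷ # 11 ∷ # 8 ∷ # 0 ∷ # 10 ∷ # 4 ∷ # 1 ∷ # 7 ∷ # 2 ∷ # 6 ∷ # 12 ∷ [])
  ∷ []))
denseTable 11 4 = just (fromRows
  ( (# 13 ∷ # 4 ∷ # 0 ∷ # 11 ∷ # 12 ∷ # 9 ∷ # 10 ∷ # 3 ∷ # 1 ∷ # 2 ∷ # 7 ∷ [])
  ∷ (# 4 ∷ # 6 ∷ # 9 ∷ # 14 ∷ # 3 ∷ # 1 ∷ # 8 ∷ # 2 ∷ # 7 ∷ # 0 ∷ # 5 ∷ [])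
  ∷ (# 8 ∷ # 12 ∷ # 10 ∷ # 0 ∷ # 14 ∷ # 5 ∷ # 1 ∷ # 6 ∷ # 2 ∷ # 13 ∷ # 11 ∷ [])
  ∷ []))
denseTable 11 5 = just (fromRows
  ( (# 12 ∷ # 5 ∷ # 0 ∷ # 2 ∷ # 4 ∷ # 7 ∷ # 11 ∷ # 14 ∷ # 1 ∷ # 8 ∷ # 10 ∷ [])
  ∷ (# 9 ∷ # 14 ∷ # 10 ∷ # 1 ∷ # 7 ∷ # 13 ∷ # 8 ∷ # 0 ∷ # 6 ∷ # 15 ∷ # 3 ∷ [])
  ∷ (# 0 ∷ # 9 ∷ # 13 ∷ # 15 ∷ # 3 ∷ # 11 ∷ # 6 ∷ # 2 ∷ # 5 ∷ # 4 ∷ # 12 ∷ [])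
  ∷ []))
denseTable 12 0 = just (fromRows
  ( (# 2 ∷ # 11 ∷ # 10 ∷ # 3 ∷ # 7 ∷ # 0 ∷ # 4 ∷ # 6 ∷ # 8 ∷ # 9 ∷ # 5 ∷ # 1 ∷ [])
  ∷ (# 5 ∷ # 1 ∷ # 3 ∷ # 11 ∷ # 8 ∷ # 9 ∷ # 0 ∷ # 7 ∷ # 6 ∷ # 4 ∷ # 10 ∷ # 2 ∷ [])
  ∷ (# 8 ∷ # 9 ∷ # 2 ∷ # 4 ∷ # 3 ∷ # 6 ∷ # 1 ∷ # 11 ∷ # 10 ∷ # 5 ∷ # 0 ∷ # 7 ∷ [])
  ∷ []))
denseTable 12 1 = just (fromRows
  ( (# 3 ∷ # 6 ∷ # 5 ∷ # 2 ∷ # 4 ∷ # 8 ∷ # 0 ∷ # 9 ∷ # 11 ∷ # 7 ∷ # 1 ∷ # 12 ∷ [])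
  ∷ (# 5 ∷ # 0 ∷ # 6 ∷ # 11 ∷ # 9 ∷ # 3 ∷ # 7 ∷ # 8 ∷ # 1 ∷ # 10 ∷ # 2 ∷ # 4 ∷ [])
  ∷ (# 0 ∷ # 8 ∷ # 10 ∷ # 4 ∷ # 7 ∷ # 12 ∷ # 2 ∷ # 5 ∷ # 9 ∷ # 1 ∷ # 3 ∷ # 6 ∷ [])
  ∷ []))
denseTable 12 2 = just (fromRows
  ( (# 3 ∷ # 6 ∷ # 4 ∷ # 7 ∷ # 1 ∷ # 8 ∷ # 5 ∷ # 13 ∷ # 2 ∷ # 10 ∷ # 9 ∷ # 0 ∷ [])
  ∷ (# 8 ∷ # 0 ∷ # 13 ∷ # 2 ∷ # 11 ∷ # 7 ∷ # 12 ∷ # 6 ∷ # 5 ∷ # 4 ∷ # 3 ∷ # 1 ∷ [])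
  ∷ (# 1 ∷ # 3 ∷ # 2 ∷ # 10 ∷ # 5 ∷ # 12 ∷ # 6 ∷ # 9 ∷ # 0 ∷ # 11 ∷ # 7 ∷ # 4 ∷ [])
  ∷ []))
denseTable 12 3 = just (fromRows
  ( (# 1 ∷ # 10 ∷ # 3 ∷ # 9 ∷ # 14 ∷ # 0 ∷ # 13 ∷ # 11 ∷ # 5 ∷ # 2 ∷ # 7 ∷ # 4 ∷ [])
  ∷ (# 3 ∷ # 1 ∷ # 10 ∷ # 4 ∷ # 8 ∷ # 12 ∷ # 5 ∷ # 9 ∷ # 2 ∷ # 14 ∷ # 6 ∷ # 0 ∷ [])
  ∷ (# 13 ∷ # 4 ∷ # 7 ∷ # 2 ∷ # 3 ∷ # 11 ∷ # 6 ∷ # 1 ∷ # 8 ∷ # 12 ∷ # 0 ∷ # 5 ∷ [])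
  ∷ []))
denseTable 12 4 = just (fromRows
  ( (# 3 ∷ # 1 ∷ # 5 ∷ # 15 ∷ # 0 ∷ # 6 ∷ # 4 ∷ # 9 ∷ # 13 ∷ # 2 ∷ # 10 ∷ # 8 ∷ [])
  ∷ (# 8 ∷ # 2 ∷ # 7 ∷ # 1 ∷ # 11 ∷ # 12 ∷ # 3 ∷ # 10 ∷ # 6 ∷ # 15 ∷ # 0 ∷ # 14 ∷ [])
  ∷ (# 12 ∷ # 3 ∷ # 1 ∷ # 11 ∷ # 13 ∷ # 9 ∷ # 7 ∷ # 14 ∷ # 2 ∷ # 5 ∷ # 4 ∷ # 0 ∷ [])
  ∷ []))
denseTable 12 5 = just (fromRows
  ( (# 1 ∷ # 3 ∷ # 6 ∷ # 11 ∷ # 9 ∷ # 15 ∷ # 0 ∷ # 12 ∷ # 13 ∷ # 14 ∷ # 10 ∷ # 2 ∷ [])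
  ∷ (# 12 ∷ # 5 ∷ # 4 ∷ # 3 ∷ # 7 ∷ # 14 ∷ # 8 ∷ # 16 ∷ # 1 ∷ # 0 ∷ # 13 ∷ # 9 ∷ [])
  ∷ (# 15 ∷ # 0 ∷ # 1 ∷ # 4 ∷ # 6 ∷ # 5 ∷ # 11 ∷ # 10 ∷ # 8 ∷ # 2 ∷ # 7 ∷ # 16 ∷ [])
  ∷ []))
denseTable 12 6 = just (fromRows
  ( (# 13 ∷ # 5 ∷ # 12 ∷ # 11 ∷ # 15 ∷ # 4 ∷ # 10 ∷ # 3 ∷ # 14 ∷ # 8 ∷ # 1 ∷ # 7 ∷ [])
  ∷ (# 11 ∷ # 6 ∷ # 17 ∷ # 2 ∷ # 5 ∷ # 14 ∷ # 1 ∷ # 16 ∷ # 0 ∷ # 3 ∷ # 9 ∷ # 12 ∷ [])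
  ∷ (# 0 ∷ # 10 ∷ # 13 ∷ # 4 ∷ # 2 ∷ # 9 ∷ # 16 ∷ # 15 ∷ # 8 ∷ # 17 ∷ # 7 ∷ # 6 ∷ [])
  ∷ []))
denseTable 13 0 = just (fromRows
  ( (# 0 ∷ # 9 ∷ # 7 ∷ # 10 ∷ # 12 ∷ # 1 ∷ # 4 ∷ # 5 ∷ # 2 ∷ # 3 ∷ # 8 ∷ # 6 ∷ # 11 ∷ [])
  ∷ (# 5 ∷ # 1 ∷ # 11 ∷ # 3 ∷ # 6 ∷ # 2 ∷ # 0 ∷ # 7 ∷ # 8 ∷ # 9 ∷ # 12 ∷ # 10 ∷ # 4 ∷ [])
  ∷ (# 6 ∷ # 10 ∷ # 12 ∷ # 7 ∷ # 2 ∷ # 4 ∷ # 8 ∷ # 1 ∷ # 3 ∷ # 0 ∷ # 5 ∷ # 11 ∷ # 9 ∷ [])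
  ∷ []))
denseTable 13 1 = just (fromRows
  ( (# 11 ∷ # 8 ∷ # 3 ∷ # 1 ∷ # 5 ∷ # 6 ∷ # 4 ∷ # 7 ∷ # 13 ∷ # 9 ∷ # 2 ∷ # 10 ∷ # 0 ∷ [])
  ∷ (# 2 ∷ # 0 ∷ # 7 ∷ # 3 ∷ # 12 ∷ # 5 ∷ # 6 ∷ # 4 ∷ # 10 ∷ # 1 ∷ # 8 ∷ # 9 ∷ # 13 ∷ [])
  ∷ (# 6 ∷ # 9 ∷ # 5 ∷ # 12 ∷ # 2 ∷ # 1 ∷ # 10 ∷ # 0 ∷ # 8 ∷ # 4 ∷ # 3 ∷ # 7 ∷ # 11 ∷ [])
  ∷ []))
denseTable 13 2 = just (fromRows
  ( (# 0 ∷ # 6 ∷ # 5 ∷ # 13 ∷ # 14 ∷ # 7 ∷ # 3 ∷ # 8 ∷ # 4 ∷ # 10 ∷ # 12 ∷ # 2 ∷ # 1 ∷ [])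
  ∷ (# 14 ∷ # 12 ∷ # 6 ∷ # 2 ∷ # 11 ∷ # 9 ∷ # 4 ∷ # 0 ∷ # 1 ∷ # 5 ∷ # 7 ∷ # 8 ∷ # 3 ∷ [])
  ∷ (# 4 ∷ # 1 ∷ # 7 ∷ # 0 ∷ # 6 ∷ # 8 ∷ # 9 ∷ # 5 ∷ # 2 ∷ # 11 ∷ # 13 ∷ # 3 ∷ # 10 ∷ [])
  ∷ []))
denseTable 13 3 = just (fromRows
  ( (# 7 ∷ # 3 ∷ # 6 ∷ # 4 ∷ # 1 ∷ # 15 ∷ # 0 ∷ # 10 ∷ # 11 ∷ # 14 ∷ # 5 ∷ # 2 ∷ # 13 ∷ [])
  ∷ (# 5 ∷ # 1 ∷ # 11 ∷ # 9 ∷ # 7 ∷ # 0 ∷ # 6 ∷ # 4 ∷ # 12 ∷ # 2 ∷ # 3 ∷ # 8 ∷ # 10 ∷ [])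
  ∷ (# 15 ∷ # 2 ∷ # 4 ∷ # 1 ∷ # 0 ∷ # 3 ∷ # 5 ∷ # 12 ∷ # 13 ∷ # 9 ∷ # 14 ∷ # 6 ∷ # 8 ∷ [])
  ∷ []))
denseTable 13 4 = just (fromRows
  ( (# 16 ∷ # 14 ∷ # 1 ∷ # 9 ∷ # 0 ∷ # 10 ∷ # 13 ∷ # 15 ∷ # 2 ∷ # 4 ∷ # 5 ∷ # 3 ∷ # 8 ∷ [])
  ∷ (# 0 ∷ # 11 ∷ # 13 ∷ # 6 ∷ # 2 ∷ # 1 ∷ # 12 ∷ # 9 ∷ # 5 ∷ # 16 ∷ # 4 ∷ # 7 ∷ # 3 ∷ [])
  ∷ (# 1 ∷ # 4 ∷ # 8 ∷ # 2 ∷ # 10 ∷ # 11 ∷ # 15 ∷ # 7 ∷ # 3 ∷ # 6 ∷ # 0 ∷ # 14 ∷ # 12 ∷ [])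
  ∷ []))
denseTable 13 5 = just (fromRows
  ( (# 2 ∷ # 16 ∷ # 7 ∷ # 3 ∷ # 8 ∷ # 4 ∷ # 17 ∷ # 10 ∷ # 0 ∷ # 13 ∷ # 6 ∷ # 12 ∷ # 1 ∷ [])
  ∷ (# 16 ∷ # 0 ∷ # 2 ∷ # 1 ∷ # 15 ∷ # 8 ∷ # 7 ∷ # 5 ∷ # 11 ∷ # 14 ∷ # 13 ∷ # 10 ∷ # 9 ∷ [])
  ∷ (# 14 ∷ # 9 ∷ # 11 ∷ # 2 ∷ # 6 ∷ # 1 ∷ # 0 ∷ # 17 ∷ # 4 ∷ # 3 ∷ # 5 ∷ # 15 ∷ # 12 ∷ [])
  ∷ []))
denseTable 13 6 = just (fromRows
  ( (# 15 ∷ # 1 ∷ # 12 ∷ # 0 ∷ # 11 ∷ # 9 ∷ # 13 ∷ # 2 ∷ # 16 ∷ # 3 ∷ # 8 ∷ # 18 ∷ # 17 ∷ [])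
  ∷ (# 0 ∷ # 4 ∷ # 6 ∷ # 2 ∷ # 10 ∷ # 14 ∷ # 17 ∷ # 7 ∷ # 1 ∷ # 11 ∷ # 9 ∷ # 12 ∷ # 5 ∷ [])
  ∷ (# 7 ∷ # 15 ∷ # 13 ∷ # 6 ∷ # 16 ∷ # 18 ∷ # 10 ∷ # 8 ∷ # 5 ∷ # 14 ∷ # 0 ∷ # 4 ∷ # 3 ∷ [])
  ∷ []))
denseTable 14 0 = just (fromRows
  ( (# 0 ∷ # 4 ∷ # 7 ∷ # 1 ∷ # 9 ∷ # 3 ∷ # 5 ∷ # 8 ∷ # 11 ∷ # 2 ∷ # 13 ∷ # 12 ∷ # 6 ∷ # 10 ∷ [])
  ∷ (# 2 ∷ # 8 ∷ # 9 ∷ # 0 ∷ # 6 ∷ # 4 ∷ # 11 ∷ # 5 ∷ # 10 ∷ # 7 ∷ # 12 ∷ # 1 ∷ # 3 ∷ # 13 ∷ [])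
  ∷ (# 13 ∷ # 2 ∷ # 4 ∷ # 10 ∷ # 12 ∷ # 0 ∷ # 1 ∷ # 9 ∷ # 7 ∷ # 5 ∷ # 11 ∷ # 3 ∷ # 8 ∷ # 6 ∷ [])
  ∷ []))
denseTable 14 1 = just (fromRows
  ( (# 4 ∷ # 1 ∷ # 6 ∷ # 5 ∷ # 8 ∷ # 13 ∷ # 7 ∷ # 11 ∷ # 10 ∷ # 0 ∷ # 12 ∷ # 3 ∷ # 9 ∷ # 2 ∷ [])
  ∷ (# 11 ∷ # 6 ∷ # 14 ∷ # 7 ∷ # 2 ∷ # 8 ∷ # 0 ∷ # 3 ∷ # 4 ∷ # 9 ∷ # 10 ∷ # 1 ∷ # 12 ∷ # 5 ∷ [])
  ∷ (# 6 ∷ # 5 ∷ # 7 ∷ # 10 ∷ # 4 ∷ # 9 ∷ # 1 ∷ # 13 ∷ # 0 ∷ # 3 ∷ # 11 ∷ # 8 ∷ # 2 ∷ # 14 ∷ [])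
  ∷ []))
denseTable 14 2 = just (fromRows
  ( (# 15 ∷ # 4 ∷ # 10 ∷ # 3 ∷ # 9 ∷ # 2 ∷ # 6 ∷ # 5 ∷ # 13 ∷ # 1 ∷ # 8 ∷ # 0 ∷ # 11 ∷ # 7 ∷ [])
  ∷ (# 2 ∷ # 7 ∷ # 14 ∷ # 5 ∷ # 12 ∷ # 6 ∷ # 4 ∷ # 8 ∷ # 9 ∷ # 3 ∷ # 15 ∷ # 1 ∷ # 10 ∷ # 0 ∷ [])
  ∷ (# 0 ∷ # 12 ∷ # 13 ∷ # 6 ∷ # 5 ∷ # 9 ∷ # 11 ∷ # 1 ∷ # 7 ∷ # 2 ∷ # 14 ∷ # 4 ∷ # 8 ∷ # 3 ∷ [])
  ∷ []))
denseTable _ _ = nothing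
-- Opaque, so that the recursions below never unfold the exhaustive check when they are type-checked.
opaque
  denseTable-withinOne : ∀ {c} → c < 15 → ∀ {t} → t < 22 → 8 ≤ c → (c + t) * 2 ≤ c * 3 → c < 14 ⊎ c + t < 3 + c →
                         BalancedEntry 2 2 (denseTable c t)
  denseTable-withinOne = from-yes (allUpTo? (λ c → allUpTo? (λ t →
    8 ≤? c →-dec (c + t) * 2 ≤? c * 3 →-dec (c <? 14 ⊎-dec c + t <? 3 + c) →-dec
    Any.dec (λ A → withinOne? A 2 2 (λrr⁻ A) 0) (denseTable c t)) 22) 15)

denseBase : ∀ {c v} → c < 15 → 8 ≤ c → c ≤ v → v * 2 ≤ c * 3 → c < 14 ⊎ v < 3 + c → BalancedArray 2 2 c v
denseBase {c} {v} c<15 8≤c c≤v v*2≤c*3 base with ≤-offset c≤v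
... | t , refl = fromEntry (denseTable-withinOne c<15 (s≤s (≤-trans (m≤n+m t c) v≤21)) 8≤c v*2≤c*3 base)
  where
  v≤21 : c + t ≤ 21
  v≤21 = *-cancelʳ-≤ (c + t) 21 2 (≤-trans v*2≤c*3 (*-monoˡ-≤ 3 (≤-pred c<15)))

v≤2+c⇒v*2≤c*3 : ∀ {c v} → v ≤ 2 + c → 4 ≤ c → v * 2 ≤ c * 3
v≤2+c⇒v*2≤c*3 {c} {v} v≤2+c 4≤c = begin
  v * 2      ≤⟨ *-monoˡ-≤ 2 v≤2+c ⟩
  4 + c * 2  ≤⟨ +-monoˡ-≤ (c * 2) 4≤c ⟩
  c + c * 2  ≡⟨ *-suc c 2 ⟨
  c * 3      ∎
  where open ≤-Reasoning

denseArray : ∀ c v → 8 ≤ c → c ≤ v → v * 2 ≤ c * 3 → BalancedArray 2 2 c v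
denseArray = <-rec _ build
  where
  build : ∀ c → (∀ {c′} → c′ < c → ∀ v → 8 ≤ c′ → c′ ≤ v → v * 2 ≤ c′ * 3 → BalancedArray 2 2 c′ v) →
          ∀ v → 8 ≤ c → c ≤ v → v * 2 ≤ c * 3 → BalancedArray 2 2 c v
  build c rec v 8≤c c≤v v*2≤c*3 with 14 ≤? c | 3 + c ≤? v | 15 ≤? c
  ... | yes 14≤c | yes 3+c≤v | _ with ≤-offset 14≤c | ≤-offset 3+c≤v
  ...   | k , refl | l , refl =
    extend (regularBlock sixColumns 3)
      (rec (m<n+m (8 + k) {6} z<s) (8 + k + l) (m≤m+n 8 k) (m≤m+n (8 + k) l)
           (+-cancelˡ-≤ 18 ((8 + k + l) * 2) ((8 + k) * 3) v*2≤c*3))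
  build c rec v 8≤c c≤v v*2≤c*3 | _ | no v≱3+c | yes 15≤c with ≤-offset 15≤c | ≤-offset c≤v
  ...   | k , refl | l , refl =
    extend (regularBlock fano 7)
      (rec (m<n+m (8 + k) {7} z<s) (8 + k + l) (m≤m+n 8 k) (m≤m+n (8 + k) l)
           (v≤2+c⇒v*2≤c*3 (+-cancelˡ-≤ 7 (8 + k + l) (2 + (8 + k)) (≤-pred (≰⇒> v≱3+c))) (m≤m+n 4 (4 + k))))
  build c rec v 8≤c c≤v v*2≤c*3 | no c≱14 | _ | _ =
    denseBase (≤-trans (≰⇒> c≱14) (n≤1+n 14)) 8≤c c≤v v*2≤c*3 (inj₁ (≰⇒> c≱14))
  build c rec v 8≤c c≤v v*2≤c*3 | yes _ | no v≱3+c | no c≱15 =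
    denseBase (≰⇒> c≱15) 8≤c c≤v v*2≤c*3 (inj₂ (≰⇒> v≱3+c))

-- 3c/2 < v < 3c

mediumTable : (c t : ℕ) → Maybe (Design 3 c (c + t))
mediumTable 8 5 = just (fromRows
  ( (# 4 ∷ # 8 ∷ # 0 ∷ # 12 ∷ # 5 ∷ # 2 ∷ # 10 ∷ # 7 ∷ [])
  ∷ (# 11 ∷ # 2 ∷ # 6 ∷ # 3 ∷ # 7 ∷ # 1 ∷ # 0 ∷ # 9 ∷ [])
  ∷ (# 5 ∷ # 3 ∷ # 4 ∷ # 1 ∷ # 6 ∷ # 10 ∷ # 9 ∷ # 8 ∷ [])
  ∷ []))
mediumTable 8 6 = just (fromRows
  ( (# 0 ∷ # 2 ∷ # 4 ∷ # 3 ∷ # 7 ∷ # 9 ∷ # 6 ∷ # 11 ∷ [])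
  ∷ (# 8 ∷ # 1 ∷ # 2 ∷ # 10 ∷ # 5 ∷ # 0 ∷ # 7 ∷ # 9 ∷ [])
  ∷ (# 3 ∷ # 6 ∷ # 13 ∷ # 5 ∷ # 4 ∷ # 12 ∷ # 8 ∷ # 1 ∷ [])
  ∷ []))
mediumTable 8 7 = just (fromRows
  ( (# 2 ∷ # 0 ∷ # 10 ∷ # 3 ∷ # 8 ∷ # 5 ∷ # 6 ∷ # 12 ∷ [])
  ∷ (# 0 ∷ # 4 ∷ # 14 ∷ # 1 ∷ # 5 ∷ # 7 ∷ # 11 ∷ # 3 ∷ [])
  ∷ (# 9 ∷ # 8 ∷ # 13 ∷ # 2 ∷ # 1 ∷ # 6 ∷ # 4 ∷ # 7 ∷ [])
  ∷ []))
mediumTable 8 8 = just (fromRows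
  ( (# 10 ∷ # 7 ∷ # 6 ∷ # 9 ∷ # 5 ∷ # 12 ∷ # 0 ∷ # 1 ∷ [])
  ∷ (# 5 ∷ # 0 ∷ # 14 ∷ # 11 ∷ # 4 ∷ # 2 ∷ # 3 ∷ # 8 ∷ [])
  ∷ (# 15 ∷ # 2 ∷ # 13 ∷ # 4 ∷ # 7 ∷ # 3 ∷ # 1 ∷ # 6 ∷ [])
  ∷ []))
mediumTable 8 9 = just (fromRows
  ( (# 13 ∷ # 5 ∷ # 16 ∷ # 1 ∷ # 0 ∷ # 6 ∷ # 4 ∷ # 12 ∷ [])
  ∷ (# 0 ∷ # 9 ∷ # 4 ∷ # 14 ∷ # 3 ∷ # 1 ∷ # 2 ∷ # 8 ∷ [])
  ∷ (# 10 ∷ # 2 ∷ # 3 ∷ # 15 ∷ # 5 ∷ # 7 ∷ # 11 ∷ # 6 ∷ [])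
  ∷ []))
mediumTable 8 10 = just (fromRows
  ( (# 6 ∷ # 0 ∷ # 2 ∷ # 1 ∷ # 16 ∷ # 8 ∷ # 9 ∷ # 3 ∷ [])
  ∷ (# 4 ∷ # 2 ∷ # 14 ∷ # 7 ∷ # 10 ∷ # 0 ∷ # 5 ∷ # 12 ∷ [])
  ∷ (# 17 ∷ # 13 ∷ # 3 ∷ # 11 ∷ # 5 ∷ # 4 ∷ # 1 ∷ # 15 ∷ [])
  ∷ []))
mediumTable 8 11 = just (fromRows
  ( (# 11 ∷ # 14 ∷ # 8 ∷ # 2 ∷ # 1 ∷ # 5 ∷ # 0 ∷ # 17 ∷ [])
  ∷ (# 12 ∷ # 4 ∷ # 1 ∷ # 16 ∷ # 10 ∷ # 2 ∷ # 6 ∷ # 3 ∷ [])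
  ∷ (# 4 ∷ # 0 ∷ # 3 ∷ # 7 ∷ # 18 ∷ # 13 ∷ # 15 ∷ # 9 ∷ [])
  ∷ []))
mediumTable 8 12 = just (fromRows
  ( (# 14 ∷ # 10 ∷ # 3 ∷ # 1 ∷ # 12 ∷ # 0 ∷ # 9 ∷ # 13 ∷ [])
  ∷ (# 6 ∷ # 18 ∷ # 19 ∷ # 2 ∷ # 8 ∷ # 1 ∷ # 4 ∷ # 17 ∷ [])
  ∷ (# 2 ∷ # 0 ∷ # 15 ∷ # 3 ∷ # 16 ∷ # 11 ∷ # 7 ∷ # 5 ∷ [])
  ∷ []))
mediumTable 8 13 = just (fromRows
  ( (# 0 ∷ # 12 ∷ # 13 ∷ # 2 ∷ # 3 ∷ # 10 ∷ # 14 ∷ # 20 ∷ [])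
  ∷ (# 1 ∷ # 18 ∷ # 0 ∷ # 5 ∷ # 11 ∷ # 16 ∷ # 7 ∷ # 4 ∷ [])
  ∷ (# 2 ∷ # 1 ∷ # 15 ∷ # 8 ∷ # 6 ∷ # 19 ∷ # 17 ∷ # 9 ∷ [])
  ∷ []))
mediumTable 8 14 = just (fromRows
  ( (# 18 ∷ # 4 ∷ # 0 ∷ # 10 ∷ # 1 ∷ # 6 ∷ # 16 ∷ # 15 ∷ [])
  ∷ (# 14 ∷ # 2 ∷ # 5 ∷ # 0 ∷ # 19 ∷ # 9 ∷ # 13 ∷ # 17 ∷ [])
  ∷ (# 1 ∷ # 20 ∷ # 7 ∷ # 3 ∷ # 12 ∷ # 8 ∷ # 21 ∷ # 11 ∷ [])
  ∷ []))
mediumTable 8 15 = just (fromRows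
  ( (# 20 ∷ # 13 ∷ # 7 ∷ # 14 ∷ # 0 ∷ # 2 ∷ # 17 ∷ # 22 ∷ [])
  ∷ (# 0 ∷ # 11 ∷ # 3 ∷ # 21 ∷ # 12 ∷ # 8 ∷ # 19 ∷ # 15 ∷ [])
  ∷ (# 5 ∷ # 10 ∷ # 16 ∷ # 1 ∷ # 4 ∷ # 6 ∷ # 18 ∷ # 9 ∷ [])
  ∷ []))
mediumTable 9 5 = just (fromRows
  ( (# 4 ∷ # 3 ∷ # 1 ∷ # 7 ∷ # 5 ∷ # 0 ∷ # 8 ∷ # 11 ∷ # 12 ∷ [])
  ∷ (# 7 ∷ # 10 ∷ # 12 ∷ # 0 ∷ # 11 ∷ # 9 ∷ # 3 ∷ # 6 ∷ # 2 ∷ [])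
  ∷ (# 2 ∷ # 4 ∷ # 6 ∷ # 13 ∷ # 10 ∷ # 1 ∷ # 9 ∷ # 8 ∷ # 5 ∷ [])
  ∷ []))
mediumTable 9 6 = just (fromRows
  ( (# 10 ∷ # 13 ∷ # 2 ∷ # 5 ∷ # 6 ∷ # 8 ∷ # 0 ∷ # 11 ∷ # 1 ∷ [])
  ∷ (# 2 ∷ # 9 ∷ # 3 ∷ # 11 ∷ # 12 ∷ # 4 ∷ # 10 ∷ # 7 ∷ # 8 ∷ [])
  ∷ (# 14 ∷ # 7 ∷ # 0 ∷ # 9 ∷ # 1 ∷ # 5 ∷ # 4 ∷ # 6 ∷ # 3 ∷ [])
  ∷ []))
mediumTable 10 6 = just (fromRows
  ( (# 12 ∷ # 8 ∷ # 11 ∷ # 10 ∷ # 0 ∷ # 7 ∷ # 4 ∷ # 5 ∷ # 14 ∷ # 1 ∷ [])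
  ∷ (# 0 ∷ # 4 ∷ # 13 ∷ # 7 ∷ # 6 ∷ # 3 ∷ # 9 ∷ # 15 ∷ # 2 ∷ # 11 ∷ [])
  ∷ (# 2 ∷ # 13 ∷ # 10 ∷ # 6 ∷ # 5 ∷ # 1 ∷ # 12 ∷ # 3 ∷ # 8 ∷ # 9 ∷ [])
  ∷ []))
mediumTable 11 6 = just (fromRows
  ( (# 6 ∷ # 14 ∷ # 1 ∷ # 9 ∷ # 8 ∷ # 0 ∷ # 2 ∷ # 5 ∷ # 11 ∷ # 15 ∷ # 13 ∷ [])
  ∷ (# 5 ∷ # 10 ∷ # 0 ∷ # 14 ∷ # 13 ∷ # 3 ∷ # 11 ∷ # 15 ∷ # 4 ∷ # 12 ∷ # 7 ∷ [])
  ∷ (# 10 ∷ # 8 ∷ # 12 ∷ # 3 ∷ # 4 ∷ # 6 ∷ # 7 ∷ # 16 ∷ # 1 ∷ # 2 ∷ # 9 ∷ [])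
  ∷ []))
mediumTable 11 7 = just (fromRows
  ( (# 14 ∷ # 0 ∷ # 8 ∷ # 9 ∷ # 15 ∷ # 5 ∷ # 13 ∷ # 10 ∷ # 12 ∷ # 7 ∷ # 6 ∷ [])
  ∷ (# 1 ∷ # 16 ∷ # 13 ∷ # 14 ∷ # 7 ∷ # 6 ∷ # 11 ∷ # 12 ∷ # 4 ∷ # 3 ∷ # 2 ∷ [])
  ∷ (# 5 ∷ # 17 ∷ # 3 ∷ # 4 ∷ # 2 ∷ # 11 ∷ # 0 ∷ # 1 ∷ # 8 ∷ # 10 ∷ # 9 ∷ [])
  ∷ []))
mediumTable 12 7 = just (fromRows
  ( (# 3 ∷ # 18 ∷ # 15 ∷ # 10 ∷ # 13 ∷ # 9 ∷ # 1 ∷ # 12 ∷ # 4 ∷ # 14 ∷ # 8 ∷ # 7 ∷ [])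
  ∷ (# 14 ∷ # 6 ∷ # 0 ∷ # 15 ∷ # 7 ∷ # 4 ∷ # 11 ∷ # 1 ∷ # 5 ∷ # 2 ∷ # 17 ∷ # 16 ∷ [])
  ∷ (# 0 ∷ # 2 ∷ # 13 ∷ # 16 ∷ # 11 ∷ # 6 ∷ # 10 ∷ # 5 ∷ # 8 ∷ # 12 ∷ # 3 ∷ # 9 ∷ [])
  ∷ []))
mediumTable 13 7 = just (fromRows
  ( (# 10 ∷ # 4 ∷ # 1 ∷ # 17 ∷ # 0 ∷ # 7 ∷ # 19 ∷ # 2 ∷ # 13 ∷ # 5 ∷ # 15 ∷ # 3 ∷ # 8 ∷ [])
  ∷ (# 12 ∷ # 0 ∷ # 10 ∷ # 2 ∷ # 11 ∷ # 13 ∷ # 16 ∷ # 18 ∷ # 6 ∷ # 14 ∷ # 9 ∷ # 15 ∷ # 5 ∷ [])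
  ∷ (# 3 ∷ # 16 ∷ # 6 ∷ # 9 ∷ # 1 ∷ # 12 ∷ # 18 ∷ # 4 ∷ # 17 ∷ # 7 ∷ # 8 ∷ # 14 ∷ # 11 ∷ [])
  ∷ []))
mediumTable 13 8 = just (fromRows
  ( (# 4 ∷ # 13 ∷ # 15 ∷ # 10 ∷ # 18 ∷ # 9 ∷ # 5 ∷ # 17 ∷ # 16 ∷ # 6 ∷ # 3 ∷ # 0 ∷ # 7 ∷ [])
  ∷ (# 19 ∷ # 0 ∷ # 2 ∷ # 5 ∷ # 9 ∷ # 1 ∷ # 8 ∷ # 11 ∷ # 15 ∷ # 7 ∷ # 17 ∷ # 14 ∷ # 12 ∷ [])
  ∷ (# 16 ∷ # 8 ∷ # 20 ∷ # 11 ∷ # 2 ∷ # 3 ∷ # 6 ∷ # 13 ∷ # 1 ∷ # 14 ∷ # 12 ∷ # 10 ∷ # 4 ∷ [])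
  ∷ []))
mediumTable _ _ = nothing
c*3<v*2⇒c≤v : ∀ {c v} → c * 3 < v * 2 → c ≤ v
c*3<v*2⇒c≤v {c} {v} c*3<v*2 = <⇒≤ (*-cancelʳ-< 2 c v (≤-<-trans (*-monoʳ-≤ c (n≤1+n 2)) c*3<v*2))

opaque
  mediumTable-withinOne : ∀ {c} → c < 14 → ∀ {t} → t < 39 → 8 ≤ c → c * 3 < (c + t) * 2 → c + t < c * 3 →
                          c < 9 ⊎ (c + t) * 2 ≤ 3 + c * 3 → BalancedEntry 1 1 (mediumTable c t)
  mediumTable-withinOne = from-yes (allUpTo? (λ c → allUpTo? (λ t →
    8 ≤? c →-dec c * 3 <? (c + t) * 2 →-dec c + t <? c * 3 →-dec (c <? 9 ⊎-dec (c + t) * 2 ≤? 3 + c * 3) →-dec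
    Any.dec (λ A → withinOne? A 1 1 (λrr⁻ A) 0) (mediumTable c t)) 39) 14)

mediumBase : ∀ {c v} → c < 14 → 8 ≤ c → c * 3 < v * 2 → v < c * 3 → c < 9 ⊎ v * 2 ≤ 3 + c * 3 →
             BalancedArray 1 1 c v
mediumBase {c} {v} c<14 8≤c c*3<v*2 v<c*3 base with ≤-offset (c*3<v*2⇒c≤v {c} {v} c*3<v*2)
... | t , refl = fromEntry (mediumTable-withinOne c<14 (≤-<-trans (m≤n+m t c) v<39) 8≤c c*3<v*2 v<c*3 base)
  where
  v<39 : c + t < 39
  v<39 = <-≤-trans v<c*3 (*-monoˡ-≤ 3 (≤-pred c<14))

v*2≤3+c*3⇒v<c*3 : ∀ {c v} → v * 2 ≤ 3 + c * 3 → 2 ≤ c → v < c * 3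
v*2≤3+c*3⇒v<c*3 {c} {v} v*2≤3+c*3 2≤c = *-cancelʳ-< 2 v (c * 3) (begin-strict
  v * 2          ≤⟨ v*2≤3+c*3 ⟩
  3 + c * 3      <⟨ +-monoˡ-< (c * 3) (≤-trans (m≤m+n 4 2) (*-monoˡ-≤ 3 2≤c)) ⟩
  c * 3 + c * 3  ≡⟨ double (c * 3) ⟩
  c * 3 * 2      ∎)
  where
  open ≤-Reasoning
  double : ∀ n → n + n ≡ n * 2
  double = solve-∀

mediumArray : ∀ c v → 8 ≤ c → c * 3 < v * 2 → v < c * 3 → BalancedArray 1 1 c v
mediumArray = <-rec _ build
  where
  build : ∀ c → (∀ {c′} → c′ < c → ∀ v → 8 ≤ c′ → c′ * 3 < v * 2 → v < c′ * 3 → BalancedArray 1 1 c′ v) →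
          ∀ v → 8 ≤ c → c * 3 < v * 2 → v < c * 3 → BalancedArray 1 1 c v
  build c rec v 8≤c c*3<v*2 v<c*3 with ≤-offset (c*3<v*2⇒c≤v {c} {v} c*3<v*2) | 9 ≤? c | 3 + c * 3 <? v * 2 | 14 ≤? c
  ... | l , refl | yes 9≤c | yes 3+c*3<v*2 | _ with ≤-offset 9≤c
  ...   | k , refl =
    extend (regularBlock oneColumn 0)
      (rec (n<1+n (8 + k)) (6 + k + l) (m≤m+n 8 k)
           (+-cancelˡ-< 6 ((8 + k) * 3) ((6 + k + l) * 2) 3+c*3<v*2)
           (+-cancelˡ-< 3 (6 + k + l) ((8 + k) * 3) v<c*3))
  build c rec v 8≤c c*3<v*2 v<c*3 | l , refl | _ | no v*2≯3+c*3 | yes 14≤c with ≤-offset 14≤c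
  ...   | k , refl =
    extend (regularBlock sixColumns 3)
      (rec (m<n+m (8 + k) {6} z<s) (5 + k + l) (m≤m+n 8 k)
           (+-cancelˡ-< 18 ((8 + k) * 3) ((5 + k + l) * 2) c*3<v*2)
           (v*2≤3+c*3⇒v<c*3 (+-cancelˡ-≤ 18 ((5 + k + l) * 2) (3 + (8 + k) * 3) (≮⇒≥ v*2≯3+c*3)) (m≤m+n 2 (6 + k))))
  build c rec v 8≤c c*3<v*2 v<c*3 | _ | no c≱9 | _ | _ =
    mediumBase (≤-trans (≰⇒> c≱9) (m≤m+n 9 5)) 8≤c c*3<v*2 v<c*3 (inj₁ (≰⇒> c≱9))
  build c rec v 8≤c c*3<v*2 v<c*3 | _ | yes _ | no v*2≯3+c*3 | no c≱14 =
    mediumBase (≰⇒> c≱14) 8≤c c*3<v*2 v<c*3 (inj₂ (≮⇒≥ v*2≯3+c*3))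

-- c ∈ {6, 7}, v < 3c

smallTable : (c t : ℕ) → Maybe (Design 3 c (c + t))
smallTable 6 0 = just (fromRows
  ( (# 0 ∷ # 2 ∷ # 5 ∷ # 1 ∷ # 4 ∷ # 3 ∷ [])
  ∷ (# 1 ∷ # 4 ∷ # 3 ∷ # 5 ∷ # 0 ∷ # 2 ∷ [])
  ∷ (# 2 ∷ # 5 ∷ # 0 ∷ # 4 ∷ # 3 ∷ # 1 ∷ [])
  ∷ []))
smallTable 6 1 = just (fromRows
  ( (# 3 ∷ # 5 ∷ # 2 ∷ # 1 ∷ # 6 ∷ # 0 ∷ [])
  ∷ (# 0 ∷ # 2 ∷ # 6 ∷ # 3 ∷ # 1 ∷ # 4 ∷ [])
  ∷ (# 5 ∷ # 1 ∷ # 3 ∷ # 4 ∷ # 0 ∷ # 2 ∷ [])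
  ∷ []))
smallTable 6 2 = just (fromRows
  ( (# 5 ∷ # 1 ∷ # 2 ∷ # 7 ∷ # 0 ∷ # 3 ∷ [])
  ∷ (# 4 ∷ # 3 ∷ # 5 ∷ # 1 ∷ # 6 ∷ # 0 ∷ [])
  ∷ (# 0 ∷ # 6 ∷ # 1 ∷ # 4 ∷ # 7 ∷ # 2 ∷ [])
  ∷ []))
smallTable 6 3 = just (fromRows
  ( (# 6 ∷ # 0 ∷ # 1 ∷ # 3 ∷ # 5 ∷ # 7 ∷ [])
  ∷ (# 1 ∷ # 5 ∷ # 4 ∷ # 7 ∷ # 8 ∷ # 2 ∷ [])
  ∷ (# 8 ∷ # 2 ∷ # 0 ∷ # 4 ∷ # 3 ∷ # 6 ∷ [])
  ∷ []))
smallTable 6 4 = just (fromRows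
  ( (# 5 ∷ # 6 ∷ # 2 ∷ # 4 ∷ # 3 ∷ # 7 ∷ [])
  ∷ (# 8 ∷ # 3 ∷ # 7 ∷ # 5 ∷ # 1 ∷ # 0 ∷ [])
  ∷ (# 6 ∷ # 0 ∷ # 9 ∷ # 1 ∷ # 2 ∷ # 4 ∷ [])
  ∷ []))
smallTable 6 5 = just (fromRows
  ( (# 6 ∷ # 2 ∷ # 1 ∷ # 8 ∷ # 3 ∷ # 4 ∷ [])
  ∷ (# 0 ∷ # 5 ∷ # 10 ∷ # 1 ∷ # 2 ∷ # 6 ∷ [])
  ∷ (# 3 ∷ # 7 ∷ # 4 ∷ # 0 ∷ # 9 ∷ # 5 ∷ [])
  ∷ []))
smallTable 6 6 = just (fromRows
  ( (# 6 ∷ # 5 ∷ # 8 ∷ # 3 ∷ # 1 ∷ # 4 ∷ [])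
  ∷ (# 2 ∷ # 1 ∷ # 10 ∷ # 5 ∷ # 0 ∷ # 7 ∷ [])
  ∷ (# 4 ∷ # 11 ∷ # 2 ∷ # 0 ∷ # 9 ∷ # 3 ∷ [])
  ∷ []))
smallTable 6 7 = just (fromRows
  ( (# 3 ∷ # 9 ∷ # 2 ∷ # 11 ∷ # 1 ∷ # 4 ∷ [])
  ∷ (# 4 ∷ # 0 ∷ # 10 ∷ # 1 ∷ # 7 ∷ # 5 ∷ [])
  ∷ (# 8 ∷ # 12 ∷ # 3 ∷ # 0 ∷ # 2 ∷ # 6 ∷ [])
  ∷ []))
smallTable 6 8 = just (fromRows
  ( (# 2 ∷ # 0 ∷ # 3 ∷ # 8 ∷ # 13 ∷ # 7 ∷ [])
  ∷ (# 6 ∷ # 12 ∷ # 4 ∷ # 2 ∷ # 1 ∷ # 3 ∷ [])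
  ∷ (# 0 ∷ # 5 ∷ # 9 ∷ # 10 ∷ # 11 ∷ # 1 ∷ [])
  ∷ []))
smallTable 6 9 = just (fromRows
  ( (# 12 ∷ # 6 ∷ # 8 ∷ # 2 ∷ # 13 ∷ # 0 ∷ [])
  ∷ (# 1 ∷ # 0 ∷ # 14 ∷ # 11 ∷ # 10 ∷ # 3 ∷ [])
  ∷ (# 2 ∷ # 9 ∷ # 5 ∷ # 7 ∷ # 1 ∷ # 4 ∷ [])
  ∷ []))
smallTable 6 10 = just (fromRows
  ( (# 7 ∷ # 4 ∷ # 5 ∷ # 10 ∷ # 0 ∷ # 14 ∷ [])
  ∷ (# 15 ∷ # 8 ∷ # 11 ∷ # 2 ∷ # 9 ∷ # 1 ∷ [])
  ∷ (# 1 ∷ # 6 ∷ # 13 ∷ # 3 ∷ # 12 ∷ # 0 ∷ [])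
  ∷ []))
smallTable 6 11 = just (fromRows
  ( (# 1 ∷ # 16 ∷ # 8 ∷ # 10 ∷ # 2 ∷ # 11 ∷ [])
  ∷ (# 3 ∷ # 6 ∷ # 5 ∷ # 0 ∷ # 15 ∷ # 9 ∷ [])
  ∷ (# 0 ∷ # 12 ∷ # 4 ∷ # 7 ∷ # 13 ∷ # 14 ∷ [])
  ∷ []))
smallTable 7 0 = just (fromRows
  ( (# 5 ∷ # 0 ∷ # 6 ∷ # 2 ∷ # 3 ∷ # 4 ∷ # 1 ∷ [])
  ∷ (# 0 ∷ # 1 ∷ # 3 ∷ # 6 ∷ # 4 ∷ # 5 ∷ # 2 ∷ [])
  ∷ (# 2 ∷ # 6 ∷ # 5 ∷ # 4 ∷ # 0 ∷ # 1 ∷ # 3 ∷ [])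
  ∷ []))
smallTable 7 1 = just (fromRows
  ( (# 2 ∷ # 6 ∷ # 0 ∷ # 1 ∷ # 3 ∷ # 5 ∷ # 4 ∷ [])
  ∷ (# 6 ∷ # 0 ∷ # 4 ∷ # 2 ∷ # 7 ∷ # 1 ∷ # 3 ∷ [])
  ∷ (# 4 ∷ # 3 ∷ # 5 ∷ # 0 ∷ # 2 ∷ # 7 ∷ # 1 ∷ [])
  ∷ []))
smallTable 7 2 = just (fromRows
  ( (# 2 ∷ # 4 ∷ # 8 ∷ # 6 ∷ # 3 ∷ # 1 ∷ # 0 ∷ [])
  ∷ (# 0 ∷ # 8 ∷ # 2 ∷ # 5 ∷ # 1 ∷ # 7 ∷ # 3 ∷ [])
  ∷ (# 1 ∷ # 0 ∷ # 7 ∷ # 2 ∷ # 6 ∷ # 4 ∷ # 5 ∷ [])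
  ∷ []))
smallTable 7 3 = just (fromRows
  ( (# 5 ∷ # 0 ∷ # 9 ∷ # 2 ∷ # 6 ∷ # 4 ∷ # 1 ∷ [])
  ∷ (# 2 ∷ # 1 ∷ # 6 ∷ # 8 ∷ # 7 ∷ # 0 ∷ # 3 ∷ [])
  ∷ (# 0 ∷ # 7 ∷ # 3 ∷ # 9 ∷ # 5 ∷ # 8 ∷ # 4 ∷ [])
  ∷ []))
smallTable 7 4 = just (fromRows
  ( (# 10 ∷ # 7 ∷ # 4 ∷ # 0 ∷ # 6 ∷ # 2 ∷ # 1 ∷ [])
  ∷ (# 5 ∷ # 8 ∷ # 6 ∷ # 3 ∷ # 9 ∷ # 0 ∷ # 7 ∷ [])
  ∷ (# 3 ∷ # 4 ∷ # 5 ∷ # 1 ∷ # 2 ∷ # 8 ∷ # 9 ∷ [])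
  ∷ []))
smallTable 7 5 = just (fromRows
  ( (# 7 ∷ # 0 ∷ # 2 ∷ # 4 ∷ # 10 ∷ # 5 ∷ # 3 ∷ [])
  ∷ (# 2 ∷ # 6 ∷ # 9 ∷ # 5 ∷ # 8 ∷ # 1 ∷ # 0 ∷ [])
  ∷ (# 8 ∷ # 7 ∷ # 3 ∷ # 6 ∷ # 4 ∷ # 11 ∷ # 1 ∷ [])
  ∷ []))
smallTable 7 6 = just (fromRows
  ( (# 2 ∷ # 0 ∷ # 8 ∷ # 5 ∷ # 6 ∷ # 3 ∷ # 1 ∷ [])
  ∷ (# 7 ∷ # 1 ∷ # 10 ∷ # 4 ∷ # 11 ∷ # 5 ∷ # 2 ∷ [])
  ∷ (# 3 ∷ # 4 ∷ # 0 ∷ # 6 ∷ # 7 ∷ # 12 ∷ # 9 ∷ [])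
  ∷ []))
smallTable 7 7 = just (fromRows
  ( (# 5 ∷ # 3 ∷ # 6 ∷ # 12 ∷ # 0 ∷ # 2 ∷ # 8 ∷ [])
  ∷ (# 0 ∷ # 4 ∷ # 7 ∷ # 1 ∷ # 3 ∷ # 9 ∷ # 6 ∷ [])
  ∷ (# 1 ∷ # 13 ∷ # 5 ∷ # 2 ∷ # 10 ∷ # 11 ∷ # 4 ∷ [])
  ∷ []))
smallTable 7 8 = just (fromRows
  ( (# 11 ∷ # 2 ∷ # 4 ∷ # 1 ∷ # 14 ∷ # 8 ∷ # 0 ∷ [])
  ∷ (# 12 ∷ # 5 ∷ # 1 ∷ # 3 ∷ # 6 ∷ # 2 ∷ # 7 ∷ [])
  ∷ (# 5 ∷ # 0 ∷ # 10 ∷ # 13 ∷ # 3 ∷ # 9 ∷ # 4 ∷ [])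
  ∷ []))
smallTable 7 9 = just (fromRows
  ( (# 1 ∷ # 15 ∷ # 0 ∷ # 3 ∷ # 11 ∷ # 10 ∷ # 4 ∷ [])
  ∷ (# 6 ∷ # 5 ∷ # 1 ∷ # 4 ∷ # 8 ∷ # 13 ∷ # 2 ∷ [])
  ∷ (# 7 ∷ # 14 ∷ # 9 ∷ # 12 ∷ # 3 ∷ # 2 ∷ # 0 ∷ [])
  ∷ []))
smallTable 7 10 = just (fromRows
  ( (# 1 ∷ # 2 ∷ # 3 ∷ # 8 ∷ # 6 ∷ # 7 ∷ # 14 ∷ [])
  ∷ (# 5 ∷ # 10 ∷ # 1 ∷ # 0 ∷ # 13 ∷ # 4 ∷ # 9 ∷ [])
  ∷ (# 2 ∷ # 12 ∷ # 0 ∷ # 11 ∷ # 15 ∷ # 3 ∷ # 16 ∷ [])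
  ∷ []))
smallTable 7 11 = just (fromRows
  ( (# 16 ∷ # 8 ∷ # 0 ∷ # 1 ∷ # 11 ∷ # 7 ∷ # 14 ∷ [])
  ∷ (# 6 ∷ # 0 ∷ # 10 ∷ # 4 ∷ # 9 ∷ # 2 ∷ # 3 ∷ [])
  ∷ (# 1 ∷ # 12 ∷ # 17 ∷ # 5 ∷ # 2 ∷ # 15 ∷ # 13 ∷ [])
  ∷ []))
smallTable 7 12 = just (fromRows
  ( (# 12 ∷ # 15 ∷ # 13 ∷ # 8 ∷ # 10 ∷ # 1 ∷ # 5 ∷ [])
  ∷ (# 9 ∷ # 6 ∷ # 1 ∷ # 0 ∷ # 11 ∷ # 4 ∷ # 16 ∷ [])
  ∷ (# 7 ∷ # 17 ∷ # 0 ∷ # 18 ∷ # 14 ∷ # 2 ∷ # 3 ∷ [])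
  ∷ []))
smallTable 7 13 = just (fromRows
  ( (# 10 ∷ # 0 ∷ # 12 ∷ # 2 ∷ # 4 ∷ # 9 ∷ # 14 ∷ [])
  ∷ (# 7 ∷ # 19 ∷ # 17 ∷ # 11 ∷ # 15 ∷ # 8 ∷ # 18 ∷ [])
  ∷ (# 6 ∷ # 1 ∷ # 16 ∷ # 13 ∷ # 5 ∷ # 0 ∷ # 3 ∷ [])
  ∷ []))
smallTable _ _ = nothing
WithinOneOfFloors : ∀ {r c v} → Design r c v → Set
WithinOneOfFloors A = WithinOne A (e⁻ A) (λrc⁻ A) (λrr⁻ A) (λcc⁻ A)

opaque
  smallTable-withinOne : ∀ {c} → c < 8 → ∀ {t} → t < 21 → 6 ≤ c → c + t < c * 3 → Any WithinOneOfFloors (smallTable c t)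
  smallTable-withinOne = from-yes (allUpTo? (λ c → allUpTo? (λ t →
    6 ≤? c →-dec c + t <? c * 3 →-dec
    Any.dec (λ A → withinOne? A (e⁻ A) (λrc⁻ A) (λrr⁻ A) (λcc⁻ A)) (smallTable c t)) 21) 8)

smallArray : ∀ {c v} → c < 8 → 6 ≤ c → c ≤ v → v < c * 3 → NearTripleArray 3 c v
smallArray {c} c<8 6≤c c≤v v<c*3 with ≤-offset c≤v
... | t , refl = uncurry (λ A w → record { array = A ; isNTA = nearTripleArray w })
                         (Any.satisfied (smallTable-withinOne c<8 (≤-<-trans (m≤n+m t c) v<21) 6≤c v<c*3))
  where
  v<21 : c + t < 21
  v<21 = <-≤-trans v<c*3 (*-monoˡ-≤ 3 (≤-pred c<8))

theorem5p10 : (c v : ℕ) → 6 ≤ c → c ≤ v → NearTripleArray 3 c v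
theorem5p10 c v 6≤c c≤v with c * 3 ≤? v | 8 ≤? c | v * 2 ≤? c * 3
... | yes c*3≤v | _ | _ with ≤-offset c*3≤v
...   | d , refl = toNearTripleArray (sparseArray c d)
theorem5p10 c v 6≤c c≤v | no c*3≰v | no c≱8  | _            = smallArray (≰⇒> c≱8) 6≤c c≤v (≰⇒> c*3≰v)
theorem5p10 c v 6≤c c≤v | no c*3≰v | yes 8≤c | yes v*2≤c*3 = toNearTripleArray (denseArray c v 8≤c c≤v v*2≤c*3)
theorem5p10 c v 6≤c c≤v | no c*3≰v | yes 8≤c | no v*2≰c*3  =
  toNearTripleArray (mediumArray c v 8≤c (≰⇒> v*2≰c*3) (≰⇒> c*3≰v))
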